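{- For every real $t$, as formal power series in $x$, $$\Lambda_0(t,x)=\alpha(x)^t+\alpha(x)^{ -t}=2\cosh\!\left(t\sinh^{ -1}\!\left(\tfrac{x}{2}\right)\right).$$
   Context: All series are formal power series in an indeterminate $x$ with real coefficients. For real $s$ and integer $m\ge 0$, $\binom{s}{m}=s(s-1)\cdots(s-m+1)/m!$. For real $s$ define $\Lambda_0(s,x)=\sum_{k\ge 0}\binom{s/2+k}{2k}\frac{s}{s/2+k}x^{2k}$, each coefficient being understood as the polynomial in $s$ it defines: the constant term is $2$ and for $k\ge1$ the coefficient of $x^{2k}$ is $\frac{s}{2k}\binom{s/2+k-1}{2k-1}$ (equivalently, $\Lambda_0(2t,x)=\sum_{k\ge0}\binom{t+k}{2k}\frac{2t}{t+k}x^{2k}$ for real $t$). Let $\sqrt{x^2+4}$ denote the formal power series $2\sum_{m\ge0}\binom{1/2}{m}(x^2/4)^m$, and let $\alpha(x)=\frac{x+\sqrt{x^2+4}}{2}$, a series with constant term $1$. For real $t$, $\alpha(x)^t:=\exp(t\log\alpha(x))$ as formal power series; equivalently $\alpha(x)^t=e^{t\sinh^{ -1}(x/2)}$, where $\cosh(y)=(e^y+e^{ -y})/2$, $\sinh(y)=(e^y-e^{ -y})/2$, and $\sinh^{ -1}$ is the compositional inverse of $\sinh$ as a formal power series. -}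

module Defs where

open import Level using (Level; _⊔_) renaming (suc to lsuc)
open import Data.Nat using (ℕ; zero; suc; _∸_)
open import Data.Integer using (+_; -[1+_])
open import Data.Rational as ℚ using (ℚ)
open import Data.Rational.Properties using (+-*-rawRing)
open import Algebra.Bundles using (CommutativeRing)
open import Algebra.Morphism.Structures using (module RingMorphisms)
open import Data.Product using (_×_)

inv1+ : ℕ → ℚ
inv1+ n = + 1 ℚ./ suc n

invFact : ℕ → ℚ
invFact zero    = ℚ.1ℚ
invFact (suc m) = invFact m ℚ.* inv1+ m

-- A commutative ℚ-algebra: a commutative ring together with a ring
-- homomorphism from ℚ.  (ℝ is the intended instance.)

record QAlgebra (c ℓ : Level) : Set (lsuc (c ⊔ ℓ)) where
  field
    commRing : CommutativeRing c ℓ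
  open CommutativeRing commRing public
  field
    ι      : ℚ → Carrier
    ι-hom  : RingMorphisms.IsRingHomomorphism +-*-rawRing rawRing ι

module PowerSeries {c ℓ : Level} (A : QAlgebra c ℓ) where
  open QAlgebra A using (Carrier; _≈_; _+_; _*_; -_; _-_; 0#; 1#; ι)

  Series : Set c
  Series = ℕ → Carrier

  _≋_ : Series → Series → Set ℓ
  f ≋ g = ∀ n → f n ≈ g n
  infix 4 _≋_

  sumTo : ℕ → (ℕ → Carrier) → Carrier
  sumTo zero    f = 0#
  sumTo (suc n) f = sumTo n f + f n

  powR : Carrier → ℕ → Carrier
  powR a zero    = 1#
  powR a (suc n) = a * powR a n

  two : Carrier
  two = 1# + 1#

  half : Carrier
  half = ι (inv1+ 1)

  const : Carrier → Series
  const a zero    = a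
  const a (suc n) = 0#

  X : Series
  X zero          = 0#
  X (suc zero)    = 1#
  X (suc (suc n)) = 0#

  _+ₛ_ : Series → Series → Series
  (f +ₛ g) n = f n + g n

  _-ₛ_ : Series → Series → Series
  (f -ₛ g) n = f n - g n

  _·ₛ_ : Carrier → Series → Series
  (a ·ₛ f) n = a * f n

  _*ₛ_ : Series → Series → Series
  (f *ₛ g) n = sumTo (suc n) (λ i → f i * g (n ∸ i))

  powS : Series → ℕ → Series
  powS f zero    = const 1#
  powS f (suc j) = f *ₛ powS f j

  -- composition f ∘ g (meaningful when g has constant term 0):
  -- coefficient n is  Σ_{j ≤ n} f_j · [x^n] g^j
  _∘ₛ_ : Series → Series → Series
  (f ∘ₛ g) n = sumTo (suc n) (λ j → f j * powS g j n)

  -- the series Σ_k a_k x^{2k}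
  evenSeries : (ℕ → Carrier) → Series
  evenSeries a zero          = a zero
  evenSeries a (suc zero)    = 0#
  evenSeries a (suc (suc n)) = evenSeries (λ k → a (suc k)) n

  -- the series Σ_k a_k x^{2k+1}
  oddSeries : (ℕ → Carrier) → Series
  oddSeries a zero          = 0#
  oddSeries a (suc zero)    = a zero
  oddSeries a (suc (suc n)) = oddSeries (λ k → a (suc k)) n

  nat : ℕ → Carrier
  nat i = ι (+ i ℚ./ 1)

  fallingProd : Carrier → ℕ → Carrier
  fallingProd s zero    = 1#
  fallingProd s (suc m) = fallingProd s m * (s - nat m)

  binom : Carrier → ℕ → Carrier
  binom s m = fallingProd s m * ι (invFact m)

  -- Λ₀(s,x) = Σ_k binom(s/2+k, 2k) · s/(s/2+k) · x^{2k}, with the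
  -- coefficients read as polynomials in s: constant term 2, and for
  -- k ≥ 1 the coefficient of x^{2k} is (s/(2k)) · binom(s/2+k-1, 2k-1).
  Λcoef : Carrier → ℕ → Carrier
  Λcoef s zero    = two
  Λcoef s (suc j) =                      -- k = j+1
    (s * ι (inv1+ (suc (2 ℕ.* j))))      -- s / (2k)
      * binom (s * half + nat j) (suc (2 ℕ.* j))
    where import Data.Nat as ℕ

  Λ₀ : Carrier → Series
  Λ₀ s = evenSeries (Λcoef s)

  -- √(x²+4) = 2 Σ_m binom(1/2, m) (x²/4)^m
  sqrtX²+4 : Series
  sqrtX²+4 = evenSeries (λ m → two * binom half m * powR (ι (inv1+ 3)) m)

  α : Series
  α = half ·ₛ (X +ₛ sqrtX²+4)

  expSeries : Series
  expSeries n = ι (invFact n)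

  log1pSeries : Series
  log1pSeries zero    = 0#
  log1pSeries (suc n) = powR (- 1#) n * ι (inv1+ n)

  sinhSeries : Series
  sinhSeries = oddSeries (λ k → ι (invFact (suc (2 ℕ.* k))))
    where import Data.Nat as ℕ

  coshSeries : Series
  coshSeries = evenSeries (λ k → ι (invFact (2 ℕ.* k)))
    where import Data.Nat as ℕ

  -- log α(x) = log(1 + (α(x) - 1))   (α has constant term 1)
  logα : Series
  logα = log1pSeries ∘ₛ (α -ₛ const 1#)

  -- α(x)^t = exp(t log α(x))
  αpow : Carrier → Series
  αpow t = expSeries ∘ₛ (t ·ₛ logα)

  IsSinhInverse : Series → Set ℓ
  IsSinhInverse h = (h 0 ≈ 0#) × (sinhSeries ∘ₛ h ≋ X) × (h ∘ₛ sinhSeries ≋ X)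

  halfX : Series
  halfX = half ·ₛ X

module Submission where

-- All three series are annihilated by the operator y ↦ (x² + 4) y″ + x y′ − t² y and have
-- constant term 2 and linear term 0. Since the leading coefficient 4 of x² + 4 is invertible,
-- the equation determines a solution from these two coefficients, so the three series agree.
-- For α^(±t) = exp (± t log α) and for cosh (t B) with B = asinh (x/2), the equation follows
-- from B′ √(x²+4) = 1 = (log α)′ √(x²+4), itself a consequence of √′ √ = x and of
-- cosh² − sinh² = 1; for Λ₀ it is the two-term recurrence of its coefficients.
-- Everything is proved over an arbitrary commutative ℚ-algebra; identities of series are
-- reduced to first-order linear equations by formal differentiation.

open import Defs
open import Data.Nat as ℕ using (ℕ; zero; suc; _∸_; z≤n; s≤s; _≤_; _<_)
import Data.Nat.Properties as ℕₚ
open import Data.Nat.Induction using (<-rec)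
open import Data.Integer as ℤ using (+_)
open import Data.Integer.Tactic.RingSolver using (solve-∀)
open import Data.Rational as ℚ using (ℚ)
open import Data.Rational.Properties using (+-*-rawRing; toℚᵘ-injective; toℚᵘ-fromℚᵘ; toℚᵘ-homo-+; toℚᵘ-homo-*)
import Data.Rational.Unnormalised as ℚᵘ
import Data.Rational.Unnormalised.Properties as ℚᵘₚ
open import Data.Empty using (⊥-elim)
open import Data.Maybe using (Maybe; just; nothing)
open import Data.Product using (_×_; _,_)
open import Relation.Nullary using (yes; no)
import Relation.Binary.PropositionalEquality as P
open import Algebra.Bundles using (CommutativeRing)
open import Algebra.Morphism.Structures using (module RingMorphisms)
import Algebra.Solver.Ring
import Algebra.Solver.Ring.AlmostCommutativeRing as ACR
import Algebra.Properties.Ring as RingProperties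
import Relation.Binary.Reasoning.Setoid as SetoidReasoning

fromℕ-suc : ∀ n → (+ suc n ℚ./ 1) P.≡ (+ n ℚ./ 1) ℚ.+ ℚ.1ℚ
fromℕ-suc n = toℚᵘ-injective (begin
  ℚ.toℚᵘ (+ suc n ℚ./ 1)            ≈⟨ toℚᵘ-fromℚᵘ (ℚᵘ.mkℚᵘ (+ suc n) 0) ⟩
  ℚᵘ.mkℚᵘ (+ suc n) 0                ≈⟨ ℚᵘ.*≡* (cross (+ n)) ⟩
  ℚᵘ.mkℚᵘ (+ n) 0 ℚᵘ.+ ℚᵘ.1ℚᵘ        ≈⟨ ℚᵘₚ.+-cong (ℚᵘₚ.≃-sym (toℚᵘ-fromℚᵘ (ℚᵘ.mkℚᵘ (+ n) 0))) ℚᵘₚ.≃-refl ⟩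
  ℚ.toℚᵘ (+ n ℚ./ 1) ℚᵘ.+ ℚᵘ.1ℚᵘ     ≈⟨ ℚᵘₚ.≃-sym (toℚᵘ-homo-+ (+ n ℚ./ 1) ℚ.1ℚ) ⟩
  ℚ.toℚᵘ ((+ n ℚ./ 1) ℚ.+ ℚ.1ℚ)      ∎)
  where
  open ℚᵘₚ.≃-Reasoning
  cross : ∀ m → (+ 1 ℤ.+ m) ℤ.* + 1 P.≡ (m ℤ.* + 1 ℤ.+ + 1 ℤ.* + 1) ℤ.* + 1
  cross = solve-∀

fromℕ-suc*inv1+ : ∀ n → (+ suc n ℚ./ 1) ℚ.* inv1+ n P.≡ ℚ.1ℚ
fromℕ-suc*inv1+ n = toℚᵘ-injective (begin
  ℚ.toℚᵘ ((+ suc n ℚ./ 1) ℚ.* inv1+ n)           ≈⟨ toℚᵘ-homo-* (+ suc n ℚ./ 1) (inv1+ n) ⟩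
  ℚ.toℚᵘ (+ suc n ℚ./ 1) ℚᵘ.* ℚ.toℚᵘ (inv1+ n)   ≈⟨ ℚᵘₚ.*-cong (toℚᵘ-fromℚᵘ (ℚᵘ.mkℚᵘ (+ suc n) 0)) (toℚᵘ-fromℚᵘ (ℚᵘ.mkℚᵘ (+ 1) n)) ⟩
  ℚᵘ.mkℚᵘ (+ suc n) 0 ℚᵘ.* ℚᵘ.mkℚᵘ (+ 1) n        ≈⟨ ℚᵘ.*≡* (cross (+ n)) ⟩
  ℚ.toℚᵘ ℚ.1ℚ                                     ∎)
  where
  open ℚᵘₚ.≃-Reasoning
  cross : ∀ m → ((+ 1 ℤ.+ m) ℤ.* + 1) ℤ.* + 1 P.≡ + 1 ℤ.* (+ 1 ℤ.* (+ 1 ℤ.+ m))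
  cross = solve-∀

module PowerSeriesCalculus {c ℓ} (A : QAlgebra c ℓ) where

  open QAlgebra A hiding (zero)
  open PowerSeries A
  open SetoidReasoning setoid
  open RingMorphisms.IsRingHomomorphism ι-hom using (1#-homo; +-homo; *-homo; 0#-homo; -‿homo)
  open RingProperties ring using (-0#≈0#; -‿distribʳ-*)

  ι-cong : ∀ {p q} → p P.≡ q → ι p ≈ ι q
  ι-cong P.refl = refl

  ιcommRingMorphism : +-*-rawRing ACR.-Raw-AlmostCommutative⟶ ACR.fromCommutativeRing commRing
  ιcommRingMorphism = record
    { ⟦_⟧ = ι ; +-homo = +-homo ; *-homo = *-homo ; -‿homo = -‿homo ; 0-homo = 0#-homo ; 1-homo = 1#-homo }

  ι-≟ : ∀ p q → Maybe (ι p ≈ ι q)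
  ι-≟ p q with p ℚ.≟ q
  ... | yes p≡q = just (ι-cong p≡q)
  ... | no _    = nothing

  open Algebra.Solver.Ring +-*-rawRing (ACR.fromCommutativeRing commRing) ιcommRingMorphism ι-≟
    using (solve; _:=_; _:+_; _:*_; _:-_; :-_; con)

  1≈ι1 : 1# ≈ ι ℚ.1ℚ
  1≈ι1 = sym 1#-homo

  q2 q4 q½ q¼ : ℚ
  q2 = + 2 ℚ./ 1
  q4 = + 4 ℚ./ 1
  q½ = + 1 ℚ./ 2
  q¼ = + 1 ℚ./ 4

  two≈ι2 : two ≈ ι q2
  two≈ι2 = sym (trans (+-homo ℚ.1ℚ ℚ.1ℚ) (+-cong 1#-homo 1#-homo))

  nat-0 : nat 0 ≈ 0#
  nat-0 = 0#-homo

  nat-suc : ∀ n → nat (suc n) ≈ nat n + 1#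
  nat-suc n = trans (ι-cong (fromℕ-suc n)) (trans (+-homo _ _) (+-congˡ 1#-homo))

  nat-1 : nat 1 ≈ 1#
  nat-1 = trans (nat-suc 0) (trans (+-congʳ nat-0) (+-identityˡ 1#))

  nat-suc*inv1+ : ∀ n → nat (suc n) * ι (inv1+ n) ≈ 1#
  nat-suc*inv1+ n = trans (sym (*-homo _ _)) (trans (ι-cong (fromℕ-suc*inv1+ n)) 1#-homo)

  nat-+ : ∀ a b → nat (a ℕ.+ b) ≈ nat a + nat b
  nat-+ zero    b = sym (trans (+-congʳ nat-0) (+-identityˡ _))
  nat-+ (suc a) b = begin
    nat (suc (a ℕ.+ b))  ≈⟨ nat-suc (a ℕ.+ b) ⟩
    nat (a ℕ.+ b) + 1#   ≈⟨ +-congʳ (nat-+ a b) ⟩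
    nat a + nat b + 1#   ≈⟨ solve 3 (λ x y z → x :+ y :+ z := x :+ z :+ y) refl (nat a) (nat b) 1# ⟩
    nat a + 1# + nat b   ≈⟨ +-congʳ (sym (nat-suc a)) ⟩
    nat (suc a) + nat b  ∎

  unit-cancelʳ : ∀ {p u x} → p * u ≈ 1# → x * p ≈ 0# → x ≈ 0#
  unit-cancelʳ {p} {u} {x} pu≈1 xp≈0 = begin
    x            ≈⟨ sym (trans (*-congˡ pu≈1) (*-identityʳ x)) ⟩
    x * (p * u)  ≈⟨ sym (*-assoc x p u) ⟩
    x * p * u    ≈⟨ *-congʳ xp≈0 ⟩
    0# * u       ≈⟨ zeroˡ u ⟩
    0#           ∎

  nat-suc-cancelˡ : ∀ n {x} → nat (suc n) * x ≈ 0# → x ≈ 0#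
  nat-suc-cancelˡ n nx≈0 = unit-cancelʳ (nat-suc*inv1+ n) (trans (*-comm _ _) nx≈0)

  sumTo-cong-< : ∀ n {f g : ℕ → Carrier} → (∀ i → i < n → f i ≈ g i) → sumTo n f ≈ sumTo n g
  sumTo-cong-< zero    f≈g = refl
  sumTo-cong-< (suc n) f≈g = +-cong (sumTo-cong-< n (λ i i<n → f≈g i (ℕₚ.m<n⇒m<1+n i<n))) (f≈g n (ℕₚ.n<1+n n))

  sumTo-cong : ∀ n {f g : ℕ → Carrier} → (∀ i → f i ≈ g i) → sumTo n f ≈ sumTo n g
  sumTo-cong n f≈g = sumTo-cong-< n (λ i _ → f≈g i)

  sumTo-vanish : ∀ n {f : ℕ → Carrier} → (∀ i → i < n → f i ≈ 0#) → sumTo n f ≈ 0#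
  sumTo-vanish zero    f≈0 = refl
  sumTo-vanish (suc n) f≈0 =
    trans (+-cong (sumTo-vanish n (λ i i<n → f≈0 i (ℕₚ.m<n⇒m<1+n i<n))) (f≈0 n (ℕₚ.n<1+n n))) (+-identityˡ 0#)

  sumTo-+ : ∀ n (f g : ℕ → Carrier) → sumTo n (λ i → f i + g i) ≈ sumTo n f + sumTo n g
  sumTo-+ zero    f g = sym (+-identityˡ 0#)
  sumTo-+ (suc n) f g = trans (+-congʳ (sumTo-+ n f g))
    (solve 4 (λ a b x y → (a :+ b) :+ (x :+ y) := (a :+ x) :+ (b :+ y)) refl (sumTo n f) (sumTo n g) (f n) (g n))

  *-distribˡ-sumTo : ∀ n a (f : ℕ → Carrier) → a * sumTo n f ≈ sumTo n (λ i → a * f i)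
  *-distribˡ-sumTo zero    a f = zeroʳ a
  *-distribˡ-sumTo (suc n) a f = trans (distribˡ a _ _) (+-congʳ (*-distribˡ-sumTo n a f))

  *-distribʳ-sumTo : ∀ n a (f : ℕ → Carrier) → sumTo n f * a ≈ sumTo n (λ i → f i * a)
  *-distribʳ-sumTo n a f = trans (*-comm _ a) (trans (*-distribˡ-sumTo n a f) (sumTo-cong n (λ i → *-comm a (f i))))

  sumTo-head : ∀ n (f : ℕ → Carrier) → sumTo (suc n) f ≈ f 0 + sumTo n (λ i → f (suc i))
  sumTo-head zero    f = trans (+-identityˡ _) (sym (+-identityʳ _))
  sumTo-head (suc n) f = trans (+-congʳ (sumTo-head n f)) (+-assoc _ _ _)

  sumTo-swap : ∀ n m (F : ℕ → ℕ → Carrier) →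
    sumTo n (λ i → sumTo m (λ j → F i j)) ≈ sumTo m (λ j → sumTo n (λ i → F i j))
  sumTo-swap zero    m F = sym (sumTo-vanish m (λ _ _ → refl))
  sumTo-swap (suc n) m F = trans (+-congʳ (sumTo-swap n m F)) (sym (sumTo-+ m (λ j → sumTo n (λ i → F i j)) (λ j → F n j)))

  sumTo-extend : ∀ {m n} (f : ℕ → Carrier) → m ≤ n → (∀ i → m ≤ i → i < n → f i ≈ 0#) → sumTo n f ≈ sumTo m f
  sumTo-extend {n = zero}  f z≤n     tail≈0 = refl
  sumTo-extend {m} {suc n} f m≤1+n tail≈0 with m ℕ.≟ suc n
  ... | yes P.refl = refl
  ... | no  m≢1+n  = trans (+-cong (sumTo-extend f m≤n (λ i m≤i i<n → tail≈0 i m≤i (ℕₚ.m<n⇒m<1+n i<n)))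
                                   (tail≈0 n m≤n (ℕₚ.n<1+n n)))
                           (+-identityʳ _)
    where m≤n = ℕₚ.≤-pred (ℕₚ.≤∧≢⇒< m≤1+n m≢1+n)

  sumTo-single : ∀ n k (f : ℕ → Carrier) → k < n → (∀ i → i < n → i P.≢ k → f i ≈ 0#) → sumTo n f ≈ f k
  sumTo-single (suc n) k f k<1+n others≈0 with k ℕ.≟ n
  ... | yes P.refl = trans (+-congʳ (sumTo-vanish n (λ i i<n → others≈0 i (ℕₚ.m<n⇒m<1+n i<n) (λ i≡n → ℕₚ.<-irrefl i≡n i<n))))
                           (+-identityˡ _)
  ... | no  k≢n    = trans (+-cong (sumTo-single n k f (ℕₚ.≤∧≢⇒< (ℕₚ.≤-pred k<1+n) k≢n)
                                      (λ i i<n → others≈0 i (ℕₚ.m<n⇒m<1+n i<n)))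
                                   (others≈0 n (ℕₚ.n<1+n n) (λ n≡k → k≢n (P.sym n≡k))))
                           (+-identityʳ _)

  sumTo-reverse : ∀ n (f : ℕ → Carrier) → sumTo (suc n) f ≈ sumTo (suc n) (λ i → f (n ∸ i))
  sumTo-reverse zero    f = refl
  sumTo-reverse (suc n) f = begin
    sumTo (suc n) f + f (suc n)                    ≈⟨ +-congʳ (sumTo-reverse n f) ⟩
    sumTo (suc n) (λ i → f (n ∸ i)) + f (suc n)    ≈⟨ +-comm _ _ ⟩
    f (suc n) + sumTo (suc n) (λ i → f (n ∸ i))    ≈⟨ sym (sumTo-head (suc n) (λ i → f (suc n ∸ i))) ⟩
    sumTo (suc (suc n)) (λ i → f (suc n ∸ i))      ∎

  sumTo-triangle : ∀ n (F : ℕ → ℕ → Carrier) →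
    sumTo (suc n) (λ i → sumTo (suc i) (λ j → F j (i ∸ j))) ≈ sumTo (suc n) (λ j → sumTo (suc (n ∸ j)) (F j))
  sumTo-triangle zero    F = refl
  sumTo-triangle (suc n) F = begin
    sumTo (suc n) (λ i → sumTo (suc i) (λ j → F j (i ∸ j))) + sumTo (suc (suc n)) (λ j → F j (suc n ∸ j))
      ≈⟨ +-cong (sumTo-triangle n F) (+-congˡ (reflexive (P.cong (F (suc n)) (ℕₚ.n∸n≡0 n)))) ⟩
    sumTo (suc n) (λ j → sumTo (suc (n ∸ j)) (F j)) + (sumTo (suc n) (λ j → F j (suc n ∸ j)) + F (suc n) 0)
      ≈⟨ sym (+-assoc _ _ _) ⟩
    sumTo (suc n) (λ j → sumTo (suc (n ∸ j)) (F j)) + sumTo (suc n) (λ j → F j (suc n ∸ j)) + F (suc n) 0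
      ≈⟨ +-congʳ (sym (sumTo-+ (suc n) _ _)) ⟩
    sumTo (suc n) (λ j → sumTo (suc (n ∸ j)) (F j) + F j (suc n ∸ j)) + F (suc n) 0
      ≈⟨ +-cong (sumTo-cong-< (suc n) (λ j j<1+n → grow j (ℕₚ.≤-pred j<1+n))) last ⟩
    sumTo (suc n) (λ j → sumTo (suc (suc n ∸ j)) (F j)) + sumTo (suc (n ∸ n)) (F (suc n))
      ∎
    where
    grow : ∀ j → j ≤ n → sumTo (suc (n ∸ j)) (F j) + F j (suc n ∸ j) ≈ sumTo (suc (suc n ∸ j)) (F j)
    grow j j≤n rewrite ℕₚ.+-∸-assoc 1 j≤n = refl
    last : F (suc n) 0 ≈ sumTo (suc (n ∸ n)) (F (suc n))
    last rewrite ℕₚ.n∸n≡0 n = sym (+-identityˡ _)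

  -- The ring of formal power series

  0ₛ 1ₛ : Series
  0ₛ = const 0#
  1ₛ = const 1#

  -ₛ_ : Series → Series
  (-ₛ f) n = - f n
  infix 8 -ₛ_

  ≋-refl : ∀ {f} → f ≋ f
  ≋-refl n = refl

  ≋-sym : ∀ {f g} → f ≋ g → g ≋ f
  ≋-sym f≋g n = sym (f≋g n)

  ≋-trans : ∀ {f g h} → f ≋ g → g ≋ h → f ≋ h
  ≋-trans f≋g g≋h n = trans (f≋g n) (g≋h n)

  const-0# : ∀ n → const 0# n ≈ 0#
  const-0# zero    = refl
  const-0# (suc n) = refl

  ≋0ₛ : ∀ {f} → (∀ n → f n ≈ 0#) → f ≋ 0ₛ
  ≋0ₛ f≈0 n = trans (f≈0 n) (sym (const-0# n))

  *ₛ-cong : ∀ {f f′ g g′} → f ≋ f′ → g ≋ g′ → f *ₛ g ≋ f′ *ₛ g′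
  *ₛ-cong f≋f′ g≋g′ n = sumTo-cong (suc n) (λ i → *-cong (f≋f′ i) (g≋g′ (n ∸ i)))

  *ₛ-comm : ∀ f g → f *ₛ g ≋ g *ₛ f
  *ₛ-comm f g n = trans (sumTo-reverse n _) (sumTo-cong-< (suc n) (λ i i<1+n →
    trans (*-comm _ _) (*-congʳ (reflexive (P.cong g (ℕₚ.m∸[m∸n]≡n (ℕₚ.≤-pred i<1+n)))))))

  *ₛ-assoc : ∀ f g h → (f *ₛ g) *ₛ h ≋ f *ₛ (g *ₛ h)
  *ₛ-assoc f g h n = begin
    sumTo (suc n) (λ i → sumTo (suc i) (λ j → f j * g (i ∸ j)) * h (n ∸ i))
      ≈⟨ sumTo-cong-< (suc n) (λ i i<1+n → trans (*-distribʳ-sumTo (suc i) _ _)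
           (sumTo-cong-< (suc i) (λ j j<1+i → reassociate i j (ℕₚ.≤-pred i<1+n) (ℕₚ.≤-pred j<1+i)))) ⟩
    sumTo (suc n) (λ i → sumTo (suc i) (λ j → F j (i ∸ j)))   ≈⟨ sumTo-triangle n F ⟩
    sumTo (suc n) (λ j → sumTo (suc (n ∸ j)) (F j))
      ≈⟨ sumTo-cong (suc n) (λ j → sym (*-distribˡ-sumTo (suc (n ∸ j)) (f j) _)) ⟩
    sumTo (suc n) (λ j → f j * sumTo (suc (n ∸ j)) (λ k → g k * h (n ∸ j ∸ k))) ∎
    where
    F : ℕ → ℕ → Carrier
    F j k = f j * (g k * h (n ∸ j ∸ k))
    reassociate : ∀ i j → i ≤ n → j ≤ i → f j * g (i ∸ j) * h (n ∸ i) ≈ F j (i ∸ j)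
    reassociate i j i≤n j≤i = trans (*-assoc _ _ _) (*-congˡ (*-congˡ (reflexive (P.cong h (P.sym n∸j∸[i∸j]≡n∸i)))))
      where
      n∸j∸[i∸j]≡n∸i : n ∸ j ∸ (i ∸ j) P.≡ n ∸ i
      n∸j∸[i∸j]≡n∸i = P.trans (ℕₚ.∸-+-assoc n j (i ∸ j)) (P.cong (n ∸_) (ℕₚ.m+[n∸m]≡n j≤i))

  *ₛ-identityˡ : ∀ f → 1ₛ *ₛ f ≋ f
  *ₛ-identityˡ f n =
    trans (sumTo-head n _) (trans (+-cong (*-identityˡ (f n)) (sumTo-vanish n (λ i _ → zeroˡ _))) (+-identityʳ _))

  *ₛ-distribˡ-+ₛ : ∀ f g h → f *ₛ (g +ₛ h) ≋ (f *ₛ g) +ₛ (f *ₛ h)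
  *ₛ-distribˡ-+ₛ f g h n = trans (sumTo-cong (suc n) (λ i → distribˡ _ _ _)) (sumTo-+ (suc n) _ _)

  seriesCommutativeRing : CommutativeRing c ℓ
  seriesCommutativeRing = record
    { Carrier = Series ; _≈_ = _≋_ ; _+_ = _+ₛ_ ; _*_ = _*ₛ_ ; -_ = -ₛ_ ; 0# = 0ₛ ; 1# = 1ₛ
    ; isCommutativeRing = record
      { isRing = record
        { +-isAbelianGroup = record
          { isGroup = record
            { isMonoid = record
              { isSemigroup = record
                { isMagma = record
                  { isEquivalence = record { refl = ≋-refl ; sym = ≋-sym ; trans = ≋-trans }
                  ; ∙-cong = λ f≋f′ g≋g′ n → +-cong (f≋f′ n) (g≋g′ n) }
                ; assoc = λ f g h n → +-assoc _ _ _ }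
              ; identity = (λ f n → trans (+-congʳ (const-0# n)) (+-identityˡ _))
                         , (λ f n → trans (+-congˡ (const-0# n)) (+-identityʳ _)) }
            ; inverse = (λ f n → trans (-‿inverseˡ _) (sym (const-0# n)))
                      , (λ f n → trans (-‿inverseʳ _) (sym (const-0# n)))
            ; ⁻¹-cong = λ f≋g n → -‿cong (f≋g n) }
          ; comm = λ f g n → +-comm _ _ }
        ; *-cong = *ₛ-cong
        ; *-assoc = *ₛ-assoc
        ; *-identity = *ₛ-identityˡ , (λ f → ≋-trans (*ₛ-comm f 1ₛ) (*ₛ-identityˡ f))
        ; distrib = *ₛ-distribˡ-+ₛ
                  , (λ f g h → ≋-trans (*ₛ-comm (g +ₛ h) f) (≋-trans (*ₛ-distribˡ-+ₛ f g h)
                      (λ n → +-cong (*ₛ-comm f g n) (*ₛ-comm f h n)))) }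
      ; *-comm = *ₛ-comm } }

  module 𝕊 = CommutativeRing seriesCommutativeRing

  const-cong : ∀ {a b} → a ≈ b → const a ≋ const b
  const-cong a≈b zero    = a≈b
  const-cong a≈b (suc n) = refl

  const-*ₛ : ∀ a f → const a *ₛ f ≋ a ·ₛ f
  const-*ₛ a f n = trans (sumTo-head n _) (trans (+-congˡ (sumTo-vanish n (λ i _ → zeroˡ _))) (+-identityʳ _))

  const-+ : ∀ a b → const (a + b) ≋ const a +ₛ const b
  const-+ a b zero    = refl
  const-+ a b (suc n) = sym (+-identityˡ 0#)

  const-* : ∀ a b → const (a * b) ≋ const a *ₛ const b
  const-* a b n = sym (trans (const-*ₛ a (const b) n) (scaled n))
    where
    scaled : ∀ n → (a ·ₛ const b) n ≈ const (a * b) n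
    scaled zero    = refl
    scaled (suc n) = zeroʳ a

  κ : ℚ → Series
  κ q = const (ι q)

  κcommRingMorphism : +-*-rawRing ACR.-Raw-AlmostCommutative⟶ ACR.fromCommutativeRing seriesCommutativeRing
  κcommRingMorphism = record
    { ⟦_⟧    = κ
    ; +-homo = λ p q → ≋-trans (const-cong (+-homo p q)) (const-+ _ _)
    ; *-homo = λ p q → ≋-trans (const-cong (*-homo p q)) (const-* _ _)
    ; -‿homo = λ { p zero → -‿homo p ; p (suc n) → sym -0#≈0# }
    ; 0-homo = const-cong 0#-homo
    ; 1-homo = const-cong 1#-homo }

  κ-≟ : ∀ p q → Maybe (κ p ≋ κ q)
  κ-≟ p q with p ℚ.≟ q
  ... | yes p≡q = just (const-cong (ι-cong p≡q))
  ... | no _    = nothing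

  open Algebra.Solver.Ring +-*-rawRing (ACR.fromCommutativeRing seriesCommutativeRing) κcommRingMorphism κ-≟
    using () renaming (solve to solveₛ; _:=_ to _⊜_; _:+_ to _⊕_; _:*_ to _⊗_; _:-_ to _⊖_; :-_ to ⊝_; con to κ̂)

  1ₛ≋κ1 : 1ₛ ≋ κ ℚ.1ℚ
  1ₛ≋κ1 = const-cong 1≈ι1

  0ₛ≋κ0 : 0ₛ ≋ κ ℚ.0ℚ
  0ₛ≋κ0 = const-cong (sym 0#-homo)

  infix  1 beginₛ_
  infixr 2 _≋⟨_⟩_
  infix  3 _∎ₛ

  beginₛ_ : ∀ {f g} → f ≋ g → f ≋ g
  beginₛ f≋g = f≋g

  _≋⟨_⟩_ : ∀ f {g h} → f ≋ g → g ≋ h → f ≋ h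
  f ≋⟨ f≋g ⟩ g≋h = ≋-trans f≋g g≋h

  _∎ₛ : ∀ f → f ≋ f
  f ∎ₛ = ≋-refl

  ≋-from-difference : ∀ f g → f -ₛ g ≋ 0ₛ → f ≋ g
  ≋-from-difference f g f-g≋0 = beginₛ
    f                    ≋⟨ solveₛ 2 (λ f g → f ⊜ (f ⊖ g) ⊕ g) 𝕊.refl f g ⟩
    (f -ₛ g) +ₛ g        ≋⟨ 𝕊.+-congʳ f-g≋0 ⟩
    0ₛ +ₛ g              ≋⟨ 𝕊.+-identityˡ g ⟩
    g                    ∎ₛ

  -- Derivative and composition

  shift : Series → Series
  shift f zero    = 0#
  shift f (suc n) = f n

  X*ₛ : ∀ f → X *ₛ f ≋ shift f
  X*ₛ f zero          = trans (+-identityˡ _) (zeroˡ _)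
  X*ₛ f (suc n)       = trans (sumTo-head (suc n) _) (trans (+-congʳ (zeroˡ _)) (trans (+-identityˡ _)
                          (trans (sumTo-head n _) (trans (+-cong (*-identityˡ _) (sumTo-vanish n (λ i _ → zeroˡ _))) (+-identityʳ _)))))

  D : Series → Series
  D f n = nat (suc n) * f (suc n)

  D-cong : ∀ {f g} → f ≋ g → D f ≋ D g
  D-cong f≋g n = *-congˡ (f≋g (suc n))

  D-+ₛ : ∀ f g → D (f +ₛ g) ≋ D f +ₛ D g
  D-+ₛ f g n = distribˡ _ _ _

  D-negₛ : ∀ f → D (-ₛ f) ≋ -ₛ D f
  D-negₛ f n = sym (-‿distribʳ-* _ _)

  D-·ₛ : ∀ a f → D (a ·ₛ f) ≋ a ·ₛ D f
  D-·ₛ a f n = solve 3 (λ x y z → x :* (y :* z) := y :* (x :* z)) refl (nat (suc n)) a (f (suc n))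

  D-const : ∀ a → D (const a) ≋ 0ₛ
  D-const a n = trans (zeroʳ _) (sym (const-0# n))

  D-X : D X ≋ 1ₛ
  D-X zero    = trans (*-identityʳ _) nat-1
  D-X (suc n) = zeroʳ _

  D-*ₛ : ∀ f g → D (f *ₛ g) ≋ (D f *ₛ g) +ₛ (f *ₛ D g)
  D-*ₛ f g n = begin
    nat (suc n) * sumTo (suc (suc n)) (λ i → f i * g (suc n ∸ i))
      ≈⟨ *-distribˡ-sumTo (suc (suc n)) _ _ ⟩
    sumTo (suc (suc n)) (λ i → nat (suc n) * (f i * g (suc n ∸ i)))
      ≈⟨ sumTo-cong-< (suc (suc n)) (λ i i<2+n → split i (ℕₚ.≤-pred i<2+n)) ⟩
    sumTo (suc (suc n)) (λ i → T₁ i + T₂ i)           ≈⟨ sumTo-+ (suc (suc n)) T₁ T₂ ⟩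
    sumTo (suc (suc n)) T₁ + sumTo (suc (suc n)) T₂    ≈⟨ +-cong sumT₁ sumT₂ ⟩
    (D f *ₛ g) n + (f *ₛ D g) n                       ∎
    where
    T₁ T₂ : ℕ → Carrier
    T₁ i = nat i * f i * g (suc n ∸ i)
    T₂ i = f i * (nat (suc n ∸ i) * g (suc n ∸ i))
    split : ∀ i → i ≤ suc n → nat (suc n) * (f i * g (suc n ∸ i)) ≈ T₁ i + T₂ i
    split i i≤1+n = begin
      nat (suc n) * (f i * g (suc n ∸ i))
        ≈⟨ *-congʳ (trans (reflexive (P.cong nat (P.sym (ℕₚ.m+[n∸m]≡n i≤1+n)))) (nat-+ i (suc n ∸ i))) ⟩
      (nat i + nat (suc n ∸ i)) * (f i * g (suc n ∸ i))
        ≈⟨ solve 4 (λ a b x y → (a :+ b) :* (x :* y) := a :* x :* y :+ x :* (b :* y)) refl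
             (nat i) (nat (suc n ∸ i)) (f i) (g (suc n ∸ i)) ⟩
      T₁ i + T₂ i ∎
    sumT₁ : sumTo (suc (suc n)) T₁ ≈ (D f *ₛ g) n
    sumT₁ = trans (sumTo-head (suc n) T₁)
      (trans (+-congʳ (trans (*-congʳ (trans (*-congʳ nat-0) (zeroˡ _))) (zeroˡ _))) (+-identityˡ _))
    sumT₂ : sumTo (suc (suc n)) T₂ ≈ (f *ₛ D g) n
    sumT₂ = trans (+-congˡ lastTerm) (trans (+-identityʳ _) (sumTo-cong-< (suc n) (λ i i<1+n →
      reflexive (P.cong (λ m → f i * (nat m * g m)) (ℕₚ.+-∸-assoc 1 (ℕₚ.≤-pred i<1+n))))))
      where
      lastTerm : T₂ (suc n) ≈ 0#
      lastTerm rewrite ℕₚ.n∸n≡0 n = trans (*-congˡ (trans (*-congʳ nat-0) (zeroˡ _))) (zeroʳ _)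

  D-κ*ₛ : ∀ q f → D (κ q *ₛ f) ≋ κ q *ₛ D f
  D-κ*ₛ q f = beginₛ
    D (κ q *ₛ f)                     ≋⟨ D-*ₛ (κ q) f ⟩
    (D (κ q) *ₛ f) +ₛ (κ q *ₛ D f)   ≋⟨ 𝕊.+-congʳ (*ₛ-cong (≋-trans (D-const (ι q)) 0ₛ≋κ0) (≋-refl {f})) ⟩
    (κ ℚ.0ℚ *ₛ f) +ₛ (κ q *ₛ D f)    ≋⟨ solveₛ 2 (λ f g → κ̂ ℚ.0ℚ ⊗ f ⊕ g ⊜ g) 𝕊.refl f (κ q *ₛ D f) ⟩
    κ q *ₛ D f                       ∎ₛ

  powS-vanish : ∀ g → g 0 ≈ 0# → ∀ j n → n < j → powS g j n ≈ 0#
  powS-vanish g g0≈0 (suc j) n n<1+j = trans (sumTo-head n _) (trans (+-cong (trans (*-congʳ g0≈0) (zeroˡ _))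
    (sumTo-vanish n (λ i i<n → trans (*-congˡ (powS-vanish g g0≈0 j (n ∸ suc i)
      (ℕₚ.<-≤-trans (ℕₚ.∸-monoʳ-< (s≤s z≤n) i<n) (ℕₚ.≤-pred n<1+j)))) (zeroʳ _)))) (+-identityʳ 0#))

  D-powS : ∀ g j → D (powS g (suc j)) ≋ const (nat (suc j)) *ₛ (powS g j *ₛ D g)
  D-powS g zero = beginₛ
    D (g *ₛ 1ₛ)                        ≋⟨ D-*ₛ g 1ₛ ⟩
    (D g *ₛ 1ₛ) +ₛ (g *ₛ D 1ₛ)         ≋⟨ 𝕊.+-cong (*ₛ-cong (≋-refl {D g}) 1ₛ≋κ1) (*ₛ-cong (≋-refl {g}) (≋-trans (D-const 1#) 0ₛ≋κ0)) ⟩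
    (D g *ₛ κ ℚ.1ℚ) +ₛ (g *ₛ κ ℚ.0ℚ)   ≋⟨ solveₛ 2 (λ g d → d ⊗ κ̂ ℚ.1ℚ ⊕ g ⊗ κ̂ ℚ.0ℚ ⊜ κ̂ ℚ.1ℚ ⊗ (κ̂ ℚ.1ℚ ⊗ d)) 𝕊.refl g (D g) ⟩
    κ ℚ.1ℚ *ₛ (κ ℚ.1ℚ *ₛ D g)          ≋⟨ *ₛ-cong (const-cong refl) (*ₛ-cong (≋-sym 1ₛ≋κ1) (≋-refl {D g})) ⟩
    const (nat 1) *ₛ (1ₛ *ₛ D g)       ∎ₛ
  D-powS g (suc j) = beginₛ
    D (g *ₛ gʲ⁺¹)                              ≋⟨ D-*ₛ g gʲ⁺¹ ⟩
    (D g *ₛ gʲ⁺¹) +ₛ (g *ₛ D gʲ⁺¹)             ≋⟨ 𝕊.+-congˡ (*ₛ-cong (≋-refl {g}) (D-powS g j)) ⟩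
    (D g *ₛ (g *ₛ gʲ)) +ₛ (g *ₛ (k *ₛ (gʲ *ₛ D g)))
      ≋⟨ solveₛ 4 (λ d g p c → d ⊗ (g ⊗ p) ⊕ g ⊗ (c ⊗ (p ⊗ d)) ⊜ (c ⊕ κ̂ ℚ.1ℚ) ⊗ ((g ⊗ p) ⊗ d)) 𝕊.refl (D g) g gʲ k ⟩
    (k +ₛ κ ℚ.1ℚ) *ₛ ((g *ₛ gʲ) *ₛ D g)        ≋⟨ *ₛ-cong k+1≋ (≋-refl {(g *ₛ gʲ) *ₛ D g}) ⟩
    const (nat (suc (suc j))) *ₛ (gʲ⁺¹ *ₛ D g) ∎ₛ
    where
    gʲ gʲ⁺¹ k : Series
    gʲ   = powS g j
    gʲ⁺¹ = powS g (suc j)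
    k    = const (nat (suc j))
    k+1≋ : k +ₛ κ ℚ.1ℚ ≋ const (nat (suc (suc j)))
    k+1≋ = ≋-sym (≋-trans (const-cong (nat-suc (suc j))) (≋-trans (const-+ _ _) (𝕊.+-congˡ 1ₛ≋κ1)))

  ∘ₛ-head : ∀ f g → (f ∘ₛ g) 0 ≈ f 0
  ∘ₛ-head f g = trans (+-identityˡ _) (*-identityʳ _)

  ∘ₛ-congˡ : ∀ {f h} g → f ≋ h → f ∘ₛ g ≋ h ∘ₛ g
  ∘ₛ-congˡ g f≋h n = sumTo-cong (suc n) (λ j → *-congʳ (f≋h j))

  ∘ₛ-distribʳ-+ₛ : ∀ f h g → (f +ₛ h) ∘ₛ g ≋ (f ∘ₛ g) +ₛ (h ∘ₛ g)
  ∘ₛ-distribʳ-+ₛ f h g n = trans (sumTo-cong (suc n) (λ j → distribʳ _ _ _)) (sumTo-+ (suc n) _ _)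

  const-∘ₛ : ∀ a g → const a ∘ₛ g ≋ const a
  const-∘ₛ a g n = trans (sumTo-head n _) (trans (+-congˡ (sumTo-vanish n (λ i _ → zeroˡ _))) (trans (+-identityʳ _) (a*1ₛ n)))
    where
    a*1ₛ : ∀ n → a * const 1# n ≈ const a n
    a*1ₛ zero    = *-identityʳ a
    a*1ₛ (suc n) = zeroʳ a

  D-∘ₛ : ∀ f g → g 0 ≈ 0# → D (f ∘ₛ g) ≋ (D f ∘ₛ g) *ₛ D g
  D-∘ₛ f g g0≈0 n = trans lhs (sym rhs)
    where
    T : ℕ → Carrier
    T j = D f j * (powS g j *ₛ D g) n
    lhs : D (f ∘ₛ g) n ≈ sumTo (suc n) T
    lhs = begin
      nat (suc n) * sumTo (suc (suc n)) (λ j → f j * powS g j (suc n))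
        ≈⟨ *-distribˡ-sumTo (suc (suc n)) _ _ ⟩
      sumTo (suc (suc n)) (λ j → nat (suc n) * (f j * powS g j (suc n)))
        ≈⟨ sumTo-cong (suc (suc n)) (λ j → solve 3 (λ a b x → a :* (b :* x) := b :* (a :* x)) refl (nat (suc n)) (f j) (powS g j (suc n))) ⟩
      sumTo (suc (suc n)) (λ j → f j * D (powS g j) n)
        ≈⟨ sumTo-head (suc n) _ ⟩
      f 0 * D 1ₛ n + sumTo (suc n) (λ j → f (suc j) * D (powS g (suc j)) n)
        ≈⟨ +-cong (trans (*-congˡ (D-const 1# n)) (trans (*-congˡ (const-0# n)) (zeroʳ _)))
                  (sumTo-cong (suc n) (λ j → trans (*-congˡ (trans (D-powS g j n) (const-*ₛ (nat (suc j)) (powS g j *ₛ D g) n))) (sym (*-assoc _ _ _)))) ⟩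
      0# + sumTo (suc n) (λ j → f (suc j) * nat (suc j) * (powS g j *ₛ D g) n)
        ≈⟨ trans (+-identityˡ _) (sumTo-cong (suc n) (λ j → *-congʳ (*-comm _ _))) ⟩
      sumTo (suc n) T ∎
    rhs : ((D f ∘ₛ g) *ₛ D g) n ≈ sumTo (suc n) T
    rhs = begin
      sumTo (suc n) (λ i → sumTo (suc i) (λ j → D f j * powS g j i) * D g (n ∸ i))
        ≈⟨ sumTo-cong (suc n) (λ i → *-distribʳ-sumTo (suc i) _ _) ⟩
      sumTo (suc n) (λ i → sumTo (suc i) (λ j → D f j * powS g j i * D g (n ∸ i)))
        ≈⟨ sumTo-cong-< (suc n) (λ i i<1+n → sym (sumTo-extend _ i<1+n (λ j i<j _ →
             trans (*-congʳ (trans (*-congˡ (powS-vanish g g0≈0 j i i<j)) (zeroʳ _))) (zeroˡ _)))) ⟩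
      sumTo (suc n) (λ i → sumTo (suc n) (λ j → D f j * powS g j i * D g (n ∸ i)))
        ≈⟨ sumTo-swap (suc n) (suc n) _ ⟩
      sumTo (suc n) (λ j → sumTo (suc n) (λ i → D f j * powS g j i * D g (n ∸ i)))
        ≈⟨ sumTo-cong (suc n) (λ j → trans (sumTo-cong (suc n) (λ i → *-assoc _ _ _)) (sym (*-distribˡ-sumTo (suc n) _ _))) ⟩
      sumTo (suc n) T ∎

  shift-∘ₛ : ∀ f g → g 0 ≈ 0# → shift f ∘ₛ g ≋ g *ₛ (f ∘ₛ g)
  shift-∘ₛ f g g0≈0 n = trans lhs (sym rhs)
    where
    T : ℕ → ℕ → Carrier
    T j i = f j * (g i * powS g j (n ∸ i))
    lhs : (shift f ∘ₛ g) n ≈ sumTo (suc n) (λ j → sumTo (suc n) (T j))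
    lhs = begin
      sumTo (suc n) (λ j → shift f j * powS g j n)
        ≈⟨ sumTo-head n _ ⟩
      0# * powS g 0 n + sumTo n (λ j → f j * powS g (suc j) n)
        ≈⟨ trans (+-congʳ (zeroˡ _)) (+-identityˡ _) ⟩
      sumTo n (λ j → f j * powS g (suc j) n)
        ≈⟨ sym (sumTo-extend _ (ℕₚ.n≤1+n n) (λ j n≤j _ → trans (*-congˡ (powS-vanish g g0≈0 (suc j) n (s≤s n≤j))) (zeroʳ _))) ⟩
      sumTo (suc n) (λ j → f j * powS g (suc j) n)
        ≈⟨ sumTo-cong (suc n) (λ j → *-distribˡ-sumTo (suc n) (f j) _) ⟩
      sumTo (suc n) (λ j → sumTo (suc n) (T j)) ∎
    rhs : (g *ₛ (f ∘ₛ g)) n ≈ sumTo (suc n) (λ j → sumTo (suc n) (T j))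
    rhs = begin
      sumTo (suc n) (λ i → g i * sumTo (suc (n ∸ i)) (λ j → f j * powS g j (n ∸ i)))
        ≈⟨ sumTo-cong (suc n) (λ i → *-distribˡ-sumTo (suc (n ∸ i)) (g i) _) ⟩
      sumTo (suc n) (λ i → sumTo (suc (n ∸ i)) (λ j → g i * (f j * powS g j (n ∸ i))))
        ≈⟨ sumTo-cong (suc n) (λ i → sym (sumTo-extend _ (s≤s (ℕₚ.m∸n≤m n i)) (λ j n∸i<j _ →
             trans (*-congˡ (trans (*-congˡ (powS-vanish g g0≈0 j (n ∸ i) n∸i<j)) (zeroʳ _))) (zeroʳ _)))) ⟩
      sumTo (suc n) (λ i → sumTo (suc n) (λ j → g i * (f j * powS g j (n ∸ i))))
        ≈⟨ sumTo-swap (suc n) (suc n) _ ⟩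
      sumTo (suc n) (λ j → sumTo (suc n) (λ i → g i * (f j * powS g j (n ∸ i))))
        ≈⟨ sumTo-cong (suc n) (λ j → sumTo-cong (suc n) (λ i →
             solve 3 (λ a b x → a :* (b :* x) := b :* (a :* x)) refl (g i) (f j) (powS g j (n ∸ i)))) ⟩
      sumTo (suc n) (λ j → sumTo (suc n) (T j)) ∎

  -- Uniqueness for linear differential equations

  *ₛ-coeff-leading : ∀ w p n → (∀ k → k < n → w k ≈ 0#) → (w *ₛ p) n ≈ w n * p 0
  *ₛ-coeff-leading w p n low≈0 = trans (+-congʳ (sumTo-vanish n (λ k k<n → trans (*-congʳ (low≈0 k k<n)) (zeroˡ _))))
    (trans (+-identityˡ _) (reflexive (P.cong (λ i → w n * p i) (ℕₚ.n∸n≡0 n))))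

  *ₛ-coeff-vanish : ∀ w p n → (∀ k → k ≤ n → w k ≈ 0#) → (w *ₛ p) n ≈ 0#
  *ₛ-coeff-vanish w p n low≈0 = sumTo-vanish (suc n) (λ k k<1+n → trans (*-congʳ (low≈0 k (ℕₚ.≤-pred k<1+n))) (zeroˡ _))

  *ₛ-unit-cancelʳ : ∀ w p u → p 0 * u ≈ 1# → w *ₛ p ≋ 0ₛ → w ≋ 0ₛ
  *ₛ-unit-cancelʳ w p u p₀u≈1 wp≋0 = ≋0ₛ (<-rec _ step)
    where
    step : ∀ n → (∀ {k} → k < n → w k ≈ 0#) → w n ≈ 0#
    step n low≈0 = unit-cancelʳ p₀u≈1 (begin
      w n * p 0     ≈⟨ sym (*ₛ-coeff-leading w p n (λ k → low≈0)) ⟩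
      (w *ₛ p) n    ≈⟨ trans (wp≋0 n) (const-0# n) ⟩
      0#            ∎)

  linearODE₁-zero : ∀ w p q u → p 0 * u ≈ 1# → w 0 ≈ 0# → D w *ₛ p ≋ w *ₛ q → w ≋ 0ₛ
  linearODE₁-zero w p q u p₀u≈1 w₀≈0 ode = ≋0ₛ (<-rec _ step)
    where
    step : ∀ n → (∀ {k} → k < n → w k ≈ 0#) → w n ≈ 0#
    step zero    _      = w₀≈0
    step (suc m) low≈0 = nat-suc-cancelˡ m (unit-cancelʳ p₀u≈1 (begin
      D w m * p 0   ≈⟨ sym (*ₛ-coeff-leading (D w) p m (λ k k<m → trans (*-congˡ (low≈0 (s≤s k<m))) (zeroʳ _))) ⟩
      (D w *ₛ p) m  ≈⟨ ode m ⟩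
      (w *ₛ q) m    ≈⟨ *ₛ-coeff-vanish w q m (λ k k≤m → low≈0 (s≤s k≤m)) ⟩
      0#            ∎))

  linearODE₂-zero : ∀ w p q r u → p 0 * u ≈ 1# → w 0 ≈ 0# → w 1 ≈ 0# →
    ((D (D w) *ₛ p) +ₛ (D w *ₛ q)) +ₛ (w *ₛ r) ≋ 0ₛ → w ≋ 0ₛ
  linearODE₂-zero w p q r u p₀u≈1 w₀≈0 w₁≈0 ode = ≋0ₛ (<-rec _ step)
    where
    step : ∀ n → (∀ {k} → k < n → w k ≈ 0#) → w n ≈ 0#
    step zero          _     = w₀≈0
    step (suc zero)    _     = w₁≈0
    step (suc (suc m)) low≈0 = nat-suc-cancelˡ (suc m) (nat-suc-cancelˡ m (unit-cancelʳ p₀u≈1 (begin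
      D (D w) m * p 0
        ≈⟨ sym (*ₛ-coeff-leading (D (D w)) p m (λ k k<m → trans (*-congˡ (trans (*-congˡ (low≈0 (s≤s (s≤s k<m)))) (zeroʳ _))) (zeroʳ _))) ⟩
      (D (D w) *ₛ p) m
        ≈⟨ sym (+-identityʳ _) ⟩
      (D (D w) *ₛ p) m + 0#
        ≈⟨ +-congˡ (sym (trans (+-cong (*ₛ-coeff-vanish (D w) q m (λ k k≤m → trans (*-congˡ (low≈0 (s≤s (s≤s k≤m)))) (zeroʳ _)))
                                       (*ₛ-coeff-vanish w r m (λ k k≤m → low≈0 (s≤s (ℕₚ.m≤n⇒m≤1+n k≤m)))))
                               (+-identityˡ 0#))) ⟩
      (D (D w) *ₛ p) m + ((D w *ₛ q) m + (w *ₛ r) m)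
        ≈⟨ sym (+-assoc _ _ _) ⟩
      (((D (D w) *ₛ p) +ₛ (D w *ₛ q)) +ₛ (w *ₛ r)) m
        ≈⟨ trans (ode m) (const-0# m) ⟩
      0# ∎)))

  double : ℕ → ℕ
  double zero    = zero
  double (suc m) = suc (suc (double m))

  double≡2* : ∀ m → double m P.≡ 2 ℕ.* m
  double≡2* zero    = P.refl
  double≡2* (suc m) = P.cong suc (P.trans (P.cong suc (double≡2* m)) (P.sym (ℕₚ.+-suc m (m ℕ.+ 0))))

  data EvenOdd : ℕ → Set where
    even : ∀ m → EvenOdd (double m)
    odd  : ∀ m → EvenOdd (suc (double m))

  evenOdd : ∀ n → EvenOdd n
  evenOdd zero          = even 0
  evenOdd (suc zero)    = odd 0
  evenOdd (suc (suc n)) with evenOdd n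
  ... | even m = even (suc m)
  ... | odd  m = odd (suc m)

  evenSeries-even : ∀ a m → evenSeries a (double m) P.≡ a m
  evenSeries-even a zero    = P.refl
  evenSeries-even a (suc m) = evenSeries-even (λ k → a (suc k)) m

  evenSeries-odd : ∀ a m → evenSeries a (suc (double m)) P.≡ 0#
  evenSeries-odd a zero    = P.refl
  evenSeries-odd a (suc m) = evenSeries-odd (λ k → a (suc k)) m

  oddSeries-even : ∀ a m → oddSeries a (double m) P.≡ 0#
  oddSeries-even a zero    = P.refl
  oddSeries-even a (suc m) = oddSeries-even (λ k → a (suc k)) m

  oddSeries-odd : ∀ a m → oddSeries a (suc (double m)) P.≡ a m
  oddSeries-odd a zero    = P.refl
  oddSeries-odd a (suc m) = oddSeries-odd (λ k → a (suc k)) m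

  nat-double : ∀ m → nat (double m) ≈ ι q2 * nat m
  nat-double zero    = trans nat-0 (sym (trans (*-congˡ nat-0) (zeroʳ _)))
  nat-double (suc m) = begin
    nat (suc (suc (double m)))                  ≈⟨ trans (nat-suc (suc (double m))) (+-congʳ (nat-suc (double m))) ⟩
    nat (double m) + 1# + 1#                    ≈⟨ +-cong (+-cong (nat-double m) 1≈ι1) 1≈ι1 ⟩
    ι q2 * nat m + ι ℚ.1ℚ + ι ℚ.1ℚ     ≈⟨ solve 1 (λ x → con q2 :* x :+ con ℚ.1ℚ :+ con ℚ.1ℚ := con q2 :* (x :+ con ℚ.1ℚ)) refl (nat m) ⟩
    ι q2 * (nat m + ι ℚ.1ℚ)            ≈⟨ *-congˡ (trans (+-congˡ (sym 1≈ι1)) (sym (nat-suc m))) ⟩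
    ι q2 * nat (suc m)                 ∎

  -- The series √(x²+4) and log α

  √ : Series
  √ = sqrtX²+4

  sqrtCoeff : ℕ → Carrier
  sqrtCoeff m = two * binom half m * powR (ι q¼) m

  sqrtCoeff-suc : ∀ m → sqrtCoeff (suc m) ≈ sqrtCoeff m * ((half - nat m) * ι (inv1+ m) * ι q¼)
  sqrtCoeff-suc m = begin
    two * (fallingProd half m * (half - nat m) * ι (invFact m ℚ.* inv1+ m)) * (ι q¼ * powR (ι q¼) m)
      ≈⟨ *-congʳ (*-congˡ (*-congˡ (*-homo (invFact m) (inv1+ m)))) ⟩
    two * (fallingProd half m * (half - nat m) * (ι (invFact m) * ι (inv1+ m))) * (ι q¼ * powR (ι q¼) m)
      ≈⟨ solve 8 (λ t F h N I r q P → t :* (F :* (h :- N) :* (I :* r)) :* (q :* P) := t :* (F :* I) :* P :* ((h :- N) :* r :* q)) refl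
           two (fallingProd half m) half (nat m) (ι (invFact m)) (ι (inv1+ m)) (ι q¼) (powR (ι q¼) m) ⟩
    sqrtCoeff m * ((half - nat m) * ι (inv1+ m) * ι q¼) ∎

  √-even : ∀ m → √ (double m) ≈ sqrtCoeff m
  √-even m = reflexive (evenSeries-even sqrtCoeff m)

  √-odd : ∀ m → √ (suc (double m)) ≈ 0#
  √-odd m = reflexive (evenSeries-odd sqrtCoeff m)

  -- Coefficientwise form of (x² + 4) √′ = x √, i.e. the binomial recurrence of the coefficients of √(x²+4).
  sqrt-recurrence : ∀ n → shift (shift (D √)) n + ι q4 * D √ n ≈ shift √ n
  sqrt-recurrence n with evenOdd n
  ... | even m = trans (+-cong (x²D√-even m) (trans (*-congˡ (trans (*-congˡ (√-odd m)) (zeroʳ _))) (zeroʳ _)))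
                       (trans (+-identityˡ 0#) (sym (x√-even m)))
    where
    x²D√-even : ∀ m → shift (shift (D √)) (double m) ≈ 0#
    x²D√-even zero    = refl
    x²D√-even (suc m) = trans (*-congˡ (√-odd m)) (zeroʳ _)
    x√-even : ∀ m → shift √ (double m) ≈ 0#
    x√-even zero    = refl
    x√-even (suc m) = √-odd m
  ... | odd m = begin
    shift (shift (D √)) (suc (double m)) + ι q4 * (nat (double (suc m)) * √ (double (suc m)))
      ≈⟨ +-cong (x²D√-odd m) (*-congˡ (*-cong nat-double+2 (trans (√-even (suc m)) (sqrtCoeff-suc m)))) ⟩
    ι q2 * N * s + ι q4 * ((ι q2 * N + ι ℚ.1ℚ + ι ℚ.1ℚ) * (s * ((ι q½ - N) * r * ι q¼)))
      ≈⟨ solve 3 (λ N s r → con q2 :* N :* s :+ con q4 :* ((con q2 :* N :+ con ℚ.1ℚ :+ con ℚ.1ℚ) :* (s :* ((con q½ :- N) :* r :* con q¼)))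
                           := con q2 :* N :* s :+ con q2 :* (con q½ :- N) :* s :* ((N :+ con ℚ.1ℚ) :* r)) refl N s r ⟩
    ι q2 * N * s + ι q2 * (ι q½ - N) * s * ((N + ι ℚ.1ℚ) * r)
      ≈⟨ +-congˡ (*-congˡ (trans (*-congʳ (trans (+-congˡ (sym 1≈ι1)) (sym (nat-suc m)))) (trans (nat-suc*inv1+ m) 1≈ι1))) ⟩
    ι q2 * N * s + ι q2 * (ι q½ - N) * s * ι ℚ.1ℚ
      ≈⟨ solve 2 (λ N s → con q2 :* N :* s :+ con q2 :* (con q½ :- N) :* s :* con ℚ.1ℚ := s) refl N s ⟩
    s ≈⟨ sym (√-even m) ⟩
    √ (double m) ∎
    where
    N s r : Carrier
    N = nat m
    s = sqrtCoeff m
    r = ι (inv1+ m)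
    nat-double+2 : nat (double (suc m)) ≈ ι q2 * N + ι ℚ.1ℚ + ι ℚ.1ℚ
    nat-double+2 = trans (nat-suc (suc (double m))) (trans (+-congʳ (nat-suc (double m))) (+-cong (+-cong (nat-double m) 1≈ι1) 1≈ι1))
    x²D√-odd : ∀ m → shift (shift (D √)) (suc (double m)) ≈ ι q2 * nat m * sqrtCoeff m
    x²D√-odd zero    = sym (trans (*-congʳ (trans (*-congˡ nat-0) (zeroʳ _))) (zeroˡ _))
    x²D√-odd (suc m) = *-cong (nat-double (suc m)) (√-even (suc m))

  x²+4 : Series
  x²+4 = (X *ₛ X) +ₛ κ q4

  x²+4-head : x²+4 0 ≈ ι q4
  x²+4-head = trans (+-congʳ (trans (+-identityˡ _) (zeroˡ _))) (+-identityˡ _)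

  x²+4-head-invertible : x²+4 0 * ι q¼ ≈ 1#
  x²+4-head-invertible = trans (*-congʳ x²+4-head) (trans (sym (*-homo q4 q¼)) 1#-homo)

  D-x²+4 : D x²+4 ≋ X +ₛ X
  D-x²+4 = beginₛ
    D x²+4                                       ≋⟨ D-+ₛ (X *ₛ X) (κ q4) ⟩
    D (X *ₛ X) +ₛ D (κ q4)                       ≋⟨ 𝕊.+-cong (D-*ₛ X X) (D-const (ι q4)) ⟩
    ((D X *ₛ X) +ₛ (X *ₛ D X)) +ₛ 0ₛ             ≋⟨ 𝕊.+-cong (𝕊.+-cong (*ₛ-cong D-X≋κ1 (≋-refl {X})) (*ₛ-cong (≋-refl {X}) D-X≋κ1)) 0ₛ≋κ0 ⟩
    ((κ ℚ.1ℚ *ₛ X) +ₛ (X *ₛ κ ℚ.1ℚ)) +ₛ κ ℚ.0ℚ   ≋⟨ solveₛ 1 (λ x → κ̂ ℚ.1ℚ ⊗ x ⊕ x ⊗ κ̂ ℚ.1ℚ ⊕ κ̂ ℚ.0ℚ ⊜ x ⊕ x) 𝕊.refl X ⟩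
    X +ₛ X                                       ∎ₛ
    where D-X≋κ1 = ≋-trans D-X 1ₛ≋κ1

  x²+4*D√ : x²+4 *ₛ D √ ≋ X *ₛ √
  x²+4*D√ = beginₛ
    x²+4 *ₛ D √                              ≋⟨ solveₛ 3 (λ x k d → (x ⊗ x ⊕ k) ⊗ d ⊜ x ⊗ (x ⊗ d) ⊕ k ⊗ d) 𝕊.refl X (κ q4) (D √) ⟩
    (X *ₛ (X *ₛ D √)) +ₛ (κ q4 *ₛ D √)       ≋⟨ 𝕊.+-cong (≋-trans (*ₛ-cong (≋-refl {X}) (X*ₛ (D √))) (X*ₛ (shift (D √)))) (const-*ₛ (ι q4) (D √)) ⟩
    shift (shift (D √)) +ₛ (ι q4 ·ₛ D √)     ≋⟨ sqrt-recurrence ⟩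
    shift √                                  ≋⟨ ≋-sym (X*ₛ √) ⟩
    X *ₛ √                                   ∎ₛ

  √-head : √ 0 ≈ ι q2
  √-head = trans (*-congʳ (trans (*-congˡ (trans (*-identityˡ _) 1#-homo)) (*-identityʳ _))) (trans (*-identityʳ _) two≈ι2)

  √-head-invertible : √ 0 * half ≈ 1#
  √-head-invertible = trans (*-congʳ √-head) (trans (sym (*-homo q2 q½)) 1#-homo)

  √*√ : √ *ₛ √ ≋ x²+4
  √*√ = ≋-from-difference (√ *ₛ √) x²+4
    (linearODE₁-zero w x²+4 (X +ₛ X) (ι q¼) x²+4-head-invertible w₀≈0 ode)
    where
    w : Series
    w = (√ *ₛ √) -ₛ x²+4
    ode : D w *ₛ x²+4 ≋ w *ₛ (X +ₛ X)
    ode = beginₛ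
      D w *ₛ x²+4
        ≋⟨ *ₛ-cong (≋-trans (D-+ₛ (√ *ₛ √) (-ₛ x²+4)) (𝕊.+-cong (D-*ₛ √ √) (≋-trans (D-negₛ x²+4) (𝕊.-‿cong D-x²+4)))) (≋-refl {x²+4}) ⟩
      (((D √ *ₛ √) +ₛ (√ *ₛ D √)) -ₛ (X +ₛ X)) *ₛ x²+4
        ≋⟨ solveₛ 4 (λ s d x q → (d ⊗ s ⊕ s ⊗ d ⊖ (x ⊕ x)) ⊗ q ⊜ (s ⊕ s) ⊗ (q ⊗ d) ⊖ (x ⊕ x) ⊗ q) 𝕊.refl √ (D √) X x²+4 ⟩
      ((√ +ₛ √) *ₛ (x²+4 *ₛ D √)) -ₛ ((X +ₛ X) *ₛ x²+4)
        ≋⟨ 𝕊.+-congʳ (*ₛ-cong (≋-refl {√ +ₛ √}) x²+4*D√) ⟩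
      ((√ +ₛ √) *ₛ (X *ₛ √)) -ₛ ((X +ₛ X) *ₛ x²+4)
        ≋⟨ solveₛ 3 (λ s x q → (s ⊕ s) ⊗ (x ⊗ s) ⊖ (x ⊕ x) ⊗ q ⊜ (s ⊗ s ⊖ q) ⊗ (x ⊕ x)) 𝕊.refl √ X x²+4 ⟩
      w *ₛ (X +ₛ X) ∎ₛ
    w₀≈0 : w 0 ≈ 0#
    w₀≈0 = begin
      0# + √ 0 * √ 0 - x²+4 0  ≈⟨ +-cong (trans (+-identityˡ _) (*-cong √-head √-head)) (-‿cong x²+4-head) ⟩
      ι q2 * ι q2 - ι q4      ≈⟨ solve 0 (con q2 :* con q2 :- con q4 := con ℚ.0ℚ) refl ⟩
      ι ℚ.0ℚ                  ≈⟨ 0#-homo ⟩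
      0#                      ∎

  √*D√ : √ *ₛ D √ ≋ X
  √*D√ = ≋-from-difference (√ *ₛ D √) X (*ₛ-unit-cancelʳ w √ half √-head-invertible (beginₛ
    w *ₛ √                          ≋⟨ solveₛ 3 (λ s d x → (s ⊗ d ⊖ x) ⊗ s ⊜ s ⊗ s ⊗ d ⊖ x ⊗ s) 𝕊.refl √ (D √) X ⟩
    ((√ *ₛ √) *ₛ D √) -ₛ (X *ₛ √)   ≋⟨ 𝕊.+-congʳ (≋-trans (*ₛ-cong √*√ (≋-refl {D √})) x²+4*D√) ⟩
    (X *ₛ √) -ₛ (X *ₛ √)            ≋⟨ 𝕊.-‿inverseʳ (X *ₛ √) ⟩
    0ₛ                              ∎ₛ))
    where
    w : Series
    w = (√ *ₛ D √) -ₛ X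

  α-head : α 0 ≈ 1#
  α-head = trans (*-congˡ (trans (+-identityˡ _) √-head)) (trans (sym (*-homo q½ q2)) 1#-homo)

  D-α*√ : D α *ₛ √ ≋ α
  D-α*√ = beginₛ
    D α *ₛ √                                 ≋⟨ *ₛ-cong D-α (≋-refl {√}) ⟩
    (κ q½ *ₛ (κ ℚ.1ℚ +ₛ D √)) *ₛ √           ≋⟨ solveₛ 2 (λ s d → κ̂ q½ ⊗ (κ̂ ℚ.1ℚ ⊕ d) ⊗ s ⊜ κ̂ q½ ⊗ (s ⊕ s ⊗ d)) 𝕊.refl √ (D √) ⟩
    κ q½ *ₛ (√ +ₛ (√ *ₛ D √))                ≋⟨ *ₛ-cong (≋-refl {κ q½}) (≋-trans (𝕊.+-congˡ √*D√) (𝕊.+-comm √ X)) ⟩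
    κ q½ *ₛ (X +ₛ √)                         ≋⟨ const-*ₛ half (X +ₛ √) ⟩
    α                                        ∎ₛ
    where
    D-α : D α ≋ κ q½ *ₛ (κ ℚ.1ℚ +ₛ D √)
    D-α = ≋-trans (D-·ₛ half (X +ₛ √)) (≋-trans (≋-sym (const-*ₛ half (D (X +ₛ √))))
            (*ₛ-cong (≋-refl {κ q½}) (≋-trans (D-+ₛ X √) (𝕊.+-congʳ (≋-trans D-X 1ₛ≋κ1)))))

  α-1 : Series
  α-1 = α -ₛ 1ₛ

  α-1-head : α-1 0 ≈ 0#
  α-1-head = trans (+-congʳ α-head) (-‿inverseʳ 1#)

  alternating : Series
  alternating n = powR (- 1#) n

  D-log1p : D log1pSeries ≋ alternating
  D-log1p n = begin
    nat (suc n) * (alternating n * ι (inv1+ n))  ≈⟨ solve 3 (λ x y z → x :* (y :* z) := y :* (x :* z)) refl (nat (suc n)) (alternating n) (ι (inv1+ n)) ⟩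
    alternating n * (nat (suc n) * ι (inv1+ n))  ≈⟨ trans (*-congˡ (nat-suc*inv1+ n)) (*-identityʳ _) ⟩
    alternating n                                ∎

  alternating+shift : alternating +ₛ shift alternating ≋ 1ₛ
  alternating+shift zero    = +-identityʳ 1#
  alternating+shift (suc n) = begin
    - 1# * alternating n + alternating n          ≈⟨ +-congʳ (*-congʳ (-‿cong 1≈ι1)) ⟩
    - ι ℚ.1ℚ * alternating n + alternating n      ≈⟨ solve 1 (λ g → :- con ℚ.1ℚ :* g :+ g := con ℚ.0ℚ) refl (alternating n) ⟩
    ι ℚ.0ℚ                                        ≈⟨ 0#-homo ⟩
    0#                                            ∎

  α⁻¹ : Series
  α⁻¹ = alternating ∘ₛ α-1

  α⁻¹*α : α⁻¹ *ₛ α ≋ 1ₛ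
  α⁻¹*α = beginₛ
    α⁻¹ *ₛ α                                 ≋⟨ *ₛ-cong (≋-refl {α⁻¹}) α≋1+[α-1] ⟩
    α⁻¹ *ₛ (κ ℚ.1ℚ +ₛ α-1)                   ≋⟨ solveₛ 2 (λ v y → v ⊗ (κ̂ ℚ.1ℚ ⊕ y) ⊜ v ⊕ y ⊗ v) 𝕊.refl α⁻¹ α-1 ⟩
    α⁻¹ +ₛ (α-1 *ₛ α⁻¹)                      ≋⟨ 𝕊.+-congˡ (≋-sym (shift-∘ₛ alternating α-1 α-1-head)) ⟩
    α⁻¹ +ₛ (shift alternating ∘ₛ α-1)        ≋⟨ ≋-sym (∘ₛ-distribʳ-+ₛ alternating (shift alternating) α-1) ⟩
    (alternating +ₛ shift alternating) ∘ₛ α-1 ≋⟨ ∘ₛ-congˡ α-1 alternating+shift ⟩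
    1ₛ ∘ₛ α-1                                ≋⟨ const-∘ₛ 1# α-1 ⟩
    1ₛ                                       ∎ₛ
    where
    α≋1+[α-1] : α ≋ κ ℚ.1ℚ +ₛ α-1
    α≋1+[α-1] = ≋-trans (solveₛ 2 (λ a o → a ⊜ o ⊕ (a ⊖ o)) 𝕊.refl α 1ₛ) (𝕊.+-congʳ 1ₛ≋κ1)

  logα-head : logα 0 ≈ 0#
  logα-head = ∘ₛ-head log1pSeries α-1

  D-logα : D logα ≋ α⁻¹ *ₛ D α
  D-logα = ≋-trans (D-∘ₛ log1pSeries α-1 α-1-head) (*ₛ-cong (∘ₛ-congˡ α-1 D-log1p) D-[α-1])
    where
    D-[α-1] : D α-1 ≋ D α
    D-[α-1] = ≋-trans (D-+ₛ α (-ₛ 1ₛ)) (≋-trans (𝕊.+-congˡ (≋-trans (D-negₛ 1ₛ) (≋-trans (𝕊.-‿cong (D-const 1#)) (≋0ₛ (λ n → trans (-‿cong (const-0# n)) -0#≈0#)))))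
                (𝕊.+-identityʳ (D α)))

  D-logα*√ : D logα *ₛ √ ≋ 1ₛ
  D-logα*√ = ≋-from-difference (D logα *ₛ √) 1ₛ (*ₛ-unit-cancelʳ w α 1# (trans (*-identityʳ _) α-head) (beginₛ
    ((D logα *ₛ √) -ₛ 1ₛ) *ₛ α
      ≋⟨ *ₛ-cong (𝕊.+-cong (*ₛ-cong D-logα (≋-refl {√})) (𝕊.-‿cong 1ₛ≋κ1)) (≋-refl {α}) ⟩
    (((α⁻¹ *ₛ D α) *ₛ √) -ₛ κ ℚ.1ℚ) *ₛ α
      ≋⟨ solveₛ 4 (λ v d s a → (v ⊗ d ⊗ s ⊖ κ̂ ℚ.1ℚ) ⊗ a ⊜ (v ⊗ a) ⊗ (d ⊗ s) ⊖ κ̂ ℚ.1ℚ ⊗ a) 𝕊.refl α⁻¹ (D α) √ α ⟩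
    ((α⁻¹ *ₛ α) *ₛ (D α *ₛ √)) -ₛ (κ ℚ.1ℚ *ₛ α)
      ≋⟨ 𝕊.+-congʳ (*ₛ-cong (≋-trans α⁻¹*α 1ₛ≋κ1) D-α*√) ⟩
    (κ ℚ.1ℚ *ₛ α) -ₛ (κ ℚ.1ℚ *ₛ α)
      ≋⟨ 𝕊.-‿inverseʳ _ ⟩
    0ₛ ∎ₛ))
    where
    w : Series
    w = (D logα *ₛ √) -ₛ 1ₛ

  -- The differential equation

  𝓛 : Carrier → Series → Series
  𝓛 t Φ = ((D (D Φ) *ₛ x²+4) +ₛ (D Φ *ₛ X)) +ₛ (Φ *ₛ (-ₛ (const t *ₛ const t)))

  -- Φ = cosh (t B) and Ψ = sinh (t B) with B′ = M = 1/√(x²+4).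
  𝓛-hyperbolicPair : ∀ t Φ Ψ M → M *ₛ √ ≋ 1ₛ → D Φ ≋ Ψ *ₛ (const t *ₛ M) → D Ψ ≋ Φ *ₛ (const t *ₛ M) → 𝓛 t Φ ≋ 0ₛ
  𝓛-hyperbolicPair t Φ Ψ M M√≋1 DΦ DΨ = beginₛ
    𝓛 t Φ
      ≋⟨ 𝕊.+-congʳ (𝕊.+-cong (*ₛ-cong (≋-refl {D (D Φ)}) (≋-sym √*√)) (*ₛ-cong (≋-refl {D Φ}) (≋-sym √*D√))) ⟩
    ((D (D Φ) *ₛ (√ *ₛ √)) +ₛ (D Φ *ₛ (√ *ₛ D √))) +ₛ (Φ *ₛ (-ₛ (T *ₛ T)))
      ≋⟨ solveₛ 6 (λ φ″ φ′ φ s s′ t → φ″ ⊗ (s ⊗ s) ⊕ φ′ ⊗ (s ⊗ s′) ⊕ φ ⊗ (⊝ (t ⊗ t)) ⊜ s ⊗ (s′ ⊗ φ′ ⊕ s ⊗ φ″) ⊖ t ⊗ t ⊗ φ)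
           𝕊.refl (D (D Φ)) (D Φ) Φ √ (D √) T ⟩
    (√ *ₛ ((D √ *ₛ D Φ) +ₛ (√ *ₛ D (D Φ)))) -ₛ ((T *ₛ T) *ₛ Φ)
      ≋⟨ 𝕊.+-congʳ (*ₛ-cong (≋-refl {√}) (≋-trans D[√*DΦ] (*ₛ-cong (≋-refl {T}) DΨ))) ⟩
    (√ *ₛ (T *ₛ (Φ *ₛ (T *ₛ M)))) -ₛ ((T *ₛ T) *ₛ Φ)
      ≋⟨ solveₛ 4 (λ φ s t m → s ⊗ (t ⊗ (φ ⊗ (t ⊗ m))) ⊖ t ⊗ t ⊗ φ ⊜ t ⊗ t ⊗ φ ⊗ (m ⊗ s) ⊖ t ⊗ t ⊗ φ) 𝕊.refl Φ √ T M ⟩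
    (((T *ₛ T) *ₛ Φ) *ₛ (M *ₛ √)) -ₛ ((T *ₛ T) *ₛ Φ)
      ≋⟨ 𝕊.+-congʳ (*ₛ-cong (≋-refl {(T *ₛ T) *ₛ Φ}) (≋-trans M√≋1 1ₛ≋κ1)) ⟩
    (((T *ₛ T) *ₛ Φ) *ₛ κ ℚ.1ℚ) -ₛ ((T *ₛ T) *ₛ Φ)
      ≋⟨ solveₛ 1 (λ y → y ⊗ κ̂ ℚ.1ℚ ⊖ y ⊜ κ̂ ℚ.0ℚ) 𝕊.refl ((T *ₛ T) *ₛ Φ) ⟩
    κ ℚ.0ℚ
      ≋⟨ ≋-sym 0ₛ≋κ0 ⟩
    0ₛ ∎ₛ
    where
    T : Series
    T = const t
    √*DΦ : √ *ₛ D Φ ≋ T *ₛ Ψ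
    √*DΦ = beginₛ
      √ *ₛ D Φ                  ≋⟨ *ₛ-cong (≋-refl {√}) DΦ ⟩
      √ *ₛ (Ψ *ₛ (T *ₛ M))      ≋⟨ solveₛ 4 (λ s ψ t m → s ⊗ (ψ ⊗ (t ⊗ m)) ⊜ t ⊗ ψ ⊗ (m ⊗ s)) 𝕊.refl √ Ψ T M ⟩
      (T *ₛ Ψ) *ₛ (M *ₛ √)      ≋⟨ *ₛ-cong (≋-refl {T *ₛ Ψ}) M√≋1 ⟩
      (T *ₛ Ψ) *ₛ 1ₛ            ≋⟨ 𝕊.*-identityʳ (T *ₛ Ψ) ⟩
      T *ₛ Ψ                    ∎ₛ
    D[√*DΦ] : (D √ *ₛ D Φ) +ₛ (√ *ₛ D (D Φ)) ≋ T *ₛ D Ψ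
    D[√*DΦ] = beginₛ
      (D √ *ₛ D Φ) +ₛ (√ *ₛ D (D Φ))  ≋⟨ ≋-sym (D-*ₛ √ (D Φ)) ⟩
      D (√ *ₛ D Φ)                    ≋⟨ D-cong √*DΦ ⟩
      D (T *ₛ Ψ)                      ≋⟨ D-*ₛ T Ψ ⟩
      (D T *ₛ Ψ) +ₛ (T *ₛ D Ψ)        ≋⟨ 𝕊.+-congʳ (≋-trans (*ₛ-cong (D-const t) (≋-refl {Ψ})) (𝕊.zeroˡ Ψ)) ⟩
      0ₛ +ₛ (T *ₛ D Ψ)                ≋⟨ 𝕊.+-identityˡ _ ⟩
      T *ₛ D Ψ                        ∎ₛ

  𝓛-+ₛ : ∀ t Φ₁ Φ₂ → 𝓛 t (Φ₁ +ₛ Φ₂) ≋ 𝓛 t Φ₁ +ₛ 𝓛 t Φ₂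
  𝓛-+ₛ t Φ₁ Φ₂ = beginₛ
    𝓛 t (Φ₁ +ₛ Φ₂)
      ≋⟨ 𝕊.+-congʳ (𝕊.+-cong (*ₛ-cong (≋-trans (D-cong (D-+ₛ Φ₁ Φ₂)) (D-+ₛ (D Φ₁) (D Φ₂))) (≋-refl {x²+4}))
                              (*ₛ-cong (D-+ₛ Φ₁ Φ₂) (≋-refl {X}))) ⟩
    (((D (D Φ₁) +ₛ D (D Φ₂)) *ₛ x²+4) +ₛ ((D Φ₁ +ₛ D Φ₂) *ₛ X)) +ₛ ((Φ₁ +ₛ Φ₂) *ₛ (-ₛ T²))
      ≋⟨ solveₛ 9 (λ a b c d e f q x t → (a ⊕ b) ⊗ q ⊕ (c ⊕ d) ⊗ x ⊕ (e ⊕ f) ⊗ (⊝ t)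
                                         ⊜ (a ⊗ q ⊕ c ⊗ x ⊕ e ⊗ (⊝ t)) ⊕ (b ⊗ q ⊕ d ⊗ x ⊕ f ⊗ (⊝ t)))
           𝕊.refl (D (D Φ₁)) (D (D Φ₂)) (D Φ₁) (D Φ₂) Φ₁ Φ₂ x²+4 X T² ⟩
    𝓛 t Φ₁ +ₛ 𝓛 t Φ₂ ∎ₛ
    where
    T² : Series
    T² = const t *ₛ const t

  𝓛-κ*ₛ : ∀ t q Φ → 𝓛 t (κ q *ₛ Φ) ≋ κ q *ₛ 𝓛 t Φ
  𝓛-κ*ₛ t q Φ = beginₛ
    𝓛 t (κ q *ₛ Φ)
      ≋⟨ 𝕊.+-congʳ (𝕊.+-cong (*ₛ-cong (≋-trans (D-cong (D-κ*ₛ q Φ)) (D-κ*ₛ q (D Φ))) (≋-refl {x²+4}))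
                              (*ₛ-cong (D-κ*ₛ q Φ) (≋-refl {X}))) ⟩
    (((κ q *ₛ D (D Φ)) *ₛ x²+4) +ₛ ((κ q *ₛ D Φ) *ₛ X)) +ₛ ((κ q *ₛ Φ) *ₛ (-ₛ T²))
      ≋⟨ solveₛ 7 (λ k a b e q x t → k ⊗ a ⊗ q ⊕ k ⊗ b ⊗ x ⊕ k ⊗ e ⊗ (⊝ t) ⊜ k ⊗ (a ⊗ q ⊕ b ⊗ x ⊕ e ⊗ (⊝ t)))
           𝕊.refl (κ q) (D (D Φ)) (D Φ) Φ x²+4 X T² ⟩
    κ q *ₛ 𝓛 t Φ ∎ₛ
    where
    T² : Series
    T² = const t *ₛ const t

  𝓛-even : ∀ t Φ → 𝓛 (- t) Φ ≋ 𝓛 t Φ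
  𝓛-even t Φ = 𝕊.+-congˡ (*ₛ-cong (≋-refl {Φ}) (𝕊.-‿cong (≋-trans (≋-sym (const-* (- t) (- t)))
    (≋-trans (const-cong (solve 1 (λ x → :- x :* :- x := x :* x) refl t)) (const-* t t)))))

  𝓛-negₛ : ∀ t Φ → 𝓛 t (-ₛ Φ) ≋ -ₛ 𝓛 t Φ
  𝓛-negₛ t Φ = beginₛ
    𝓛 t (-ₛ Φ)
      ≋⟨ 𝕊.+-congʳ (𝕊.+-cong (*ₛ-cong (≋-trans (D-cong (D-negₛ Φ)) (D-negₛ (D Φ))) (≋-refl {x²+4}))
                              (*ₛ-cong (D-negₛ Φ) (≋-refl {X}))) ⟩
    (((-ₛ D (D Φ)) *ₛ x²+4) +ₛ ((-ₛ D Φ) *ₛ X)) +ₛ ((-ₛ Φ) *ₛ (-ₛ T²))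
      ≋⟨ solveₛ 6 (λ a b e q x t → (⊝ a) ⊗ q ⊕ (⊝ b) ⊗ x ⊕ (⊝ e) ⊗ (⊝ t) ⊜ ⊝ (a ⊗ q ⊕ b ⊗ x ⊕ e ⊗ (⊝ t)))
           𝕊.refl (D (D Φ)) (D Φ) Φ x²+4 X T² ⟩
    -ₛ 𝓛 t Φ ∎ₛ
    where
    T² : Series
    T² = const t *ₛ const t

  𝓛-unique : ∀ t Φ₁ Φ₂ → 𝓛 t Φ₁ ≋ 0ₛ → 𝓛 t Φ₂ ≋ 0ₛ → Φ₁ 0 ≈ Φ₂ 0 → Φ₁ 1 ≈ Φ₂ 1 → Φ₁ ≋ Φ₂
  𝓛-unique t Φ₁ Φ₂ 𝓛Φ₁≋0 𝓛Φ₂≋0 Φ₁₀≈Φ₂₀ Φ₁₁≈Φ₂₁ = ≋-from-difference Φ₁ Φ₂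
    (linearODE₂-zero (Φ₁ -ₛ Φ₂) x²+4 X (-ₛ (const t *ₛ const t)) (ι q¼) x²+4-head-invertible
      (trans (+-congʳ Φ₁₀≈Φ₂₀) (-‿inverseʳ _)) (trans (+-congʳ Φ₁₁≈Φ₂₁) (-‿inverseʳ _)) (beginₛ
        𝓛 t (Φ₁ +ₛ (-ₛ Φ₂))        ≋⟨ 𝓛-+ₛ t Φ₁ (-ₛ Φ₂) ⟩
        𝓛 t Φ₁ +ₛ 𝓛 t (-ₛ Φ₂)      ≋⟨ 𝕊.+-cong 𝓛Φ₁≋0 (≋-trans (𝓛-negₛ t Φ₂) (𝕊.-‿cong 𝓛Φ₂≋0)) ⟩
        0ₛ +ₛ (-ₛ 0ₛ)              ≋⟨ 𝕊.-‿inverseʳ 0ₛ ⟩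
        0ₛ                         ∎ₛ))

  D-exp : D expSeries ≋ expSeries
  D-exp n = begin
    nat (suc n) * ι (invFact n ℚ.* inv1+ n)          ≈⟨ *-congˡ (*-homo (invFact n) (inv1+ n)) ⟩
    nat (suc n) * (ι (invFact n) * ι (inv1+ n))      ≈⟨ solve 3 (λ x y z → x :* (y :* z) := y :* (x :* z)) refl (nat (suc n)) (ι (invFact n)) (ι (inv1+ n)) ⟩
    ι (invFact n) * (nat (suc n) * ι (inv1+ n))      ≈⟨ trans (*-congˡ (nat-suc*inv1+ n)) (*-identityʳ _) ⟩
    ι (invFact n)                                    ∎

  D-αpow : ∀ t → D (αpow t) ≋ αpow t *ₛ (const t *ₛ D logα)
  D-αpow t = beginₛ
    D (αpow t)                                       ≋⟨ D-∘ₛ expSeries (t ·ₛ logα) (trans (*-congˡ logα-head) (zeroʳ t)) ⟩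
    (D expSeries ∘ₛ (t ·ₛ logα)) *ₛ D (t ·ₛ logα)    ≋⟨ *ₛ-cong (∘ₛ-congˡ (t ·ₛ logα) D-exp) (≋-trans (D-·ₛ t logα) (≋-sym (const-*ₛ t (D logα)))) ⟩
    αpow t *ₛ (const t *ₛ D logα)                    ∎ₛ

  αpow-head : ∀ t → αpow t 0 ≈ 1#
  αpow-head t = trans (∘ₛ-head expSeries (t ·ₛ logα)) 1#-homo

  coeff-1 : ∀ t Φ Ψ M → D Φ ≋ Ψ *ₛ (const t *ₛ M) → Φ 1 ≈ Ψ 0 * (t * M 0)
  coeff-1 t Φ Ψ M DΦ = begin
    Φ 1                          ≈⟨ sym (trans (*-congʳ nat-1) (*-identityˡ _)) ⟩
    D Φ 0                        ≈⟨ DΦ 0 ⟩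
    0# + Ψ 0 * (0# + t * M 0)    ≈⟨ trans (+-identityˡ _) (*-congˡ (+-identityˡ _)) ⟩
    Ψ 0 * (t * M 0)              ∎

  α± : Carrier → Series
  α± t = αpow t +ₛ αpow (- t)

  𝓛-α± : ∀ t → 𝓛 t (α± t) ≋ 0ₛ
  𝓛-α± t = beginₛ
    𝓛 t (αpow t +ₛ αpow (- t))         ≋⟨ 𝓛-+ₛ t (αpow t) (αpow (- t)) ⟩
    𝓛 t (αpow t) +ₛ 𝓛 t (αpow (- t))   ≋⟨ 𝕊.+-cong (𝓛-αpow t) (≋-trans (≋-sym (𝓛-even t (αpow (- t)))) (𝓛-αpow (- t))) ⟩
    0ₛ +ₛ 0ₛ                           ≋⟨ 𝕊.+-identityˡ 0ₛ ⟩
    0ₛ                                 ∎ₛ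
    where
    𝓛-αpow : ∀ t → 𝓛 t (αpow t) ≋ 0ₛ
    𝓛-αpow t = 𝓛-hyperbolicPair t (αpow t) (αpow t) (D logα) D-logα*√ (D-αpow t) (D-αpow t)

  α±-head : ∀ t → α± t 0 ≈ two
  α±-head t = +-cong (αpow-head t) (αpow-head (- t))

  α±-coeff-1 : ∀ t → α± t 1 ≈ 0#
  α±-coeff-1 t = begin
    αpow t 1 + αpow (- t) 1
      ≈⟨ +-cong (coeff-1 t (αpow t) (αpow t) (D logα) (D-αpow t)) (coeff-1 (- t) (αpow (- t)) (αpow (- t)) (D logα) (D-αpow (- t))) ⟩
    αpow t 0 * (t * D logα 0) + αpow (- t) 0 * (- t * D logα 0)
      ≈⟨ +-cong (*-congʳ (trans (αpow-head t) 1≈ι1)) (*-congʳ (trans (αpow-head (- t)) 1≈ι1)) ⟩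
    ι ℚ.1ℚ * (t * D logα 0) + ι ℚ.1ℚ * (- t * D logα 0)
      ≈⟨ solve 2 (λ x y → con ℚ.1ℚ :* (x :* y) :+ con ℚ.1ℚ :* (:- x :* y) := con ℚ.0ℚ) refl t (D logα 0) ⟩
    ι ℚ.0ℚ
      ≈⟨ 0#-homo ⟩
    0# ∎

  𝓛-coeff : ∀ t Φ → 𝓛 t Φ ≋ λ n → shift (shift (D (D Φ))) n + ι q4 * D (D Φ) n + shift (D Φ) n + - (t * t * Φ n)
  𝓛-coeff t Φ = beginₛ
    𝓛 t Φ
      ≋⟨ 𝕊.+-congˡ (*ₛ-cong (≋-refl {Φ}) (𝕊.-‿cong (≋-sym (const-* t t)))) ⟩
    ((D (D Φ) *ₛ x²+4) +ₛ (D Φ *ₛ X)) +ₛ (Φ *ₛ (-ₛ const (t * t)))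
      ≋⟨ solveₛ 6 (λ φ″ φ′ φ x k t² → φ″ ⊗ (x ⊗ x ⊕ k) ⊕ φ′ ⊗ x ⊕ φ ⊗ (⊝ t²) ⊜ x ⊗ (x ⊗ φ″) ⊕ k ⊗ φ″ ⊕ x ⊗ φ′ ⊕ ⊝ (t² ⊗ φ))
           𝕊.refl (D (D Φ)) (D Φ) Φ X (κ q4) (const (t * t)) ⟩
    (((X *ₛ (X *ₛ D (D Φ))) +ₛ (κ q4 *ₛ D (D Φ))) +ₛ (X *ₛ D Φ)) +ₛ (-ₛ (const (t * t) *ₛ Φ))
      ≋⟨ 𝕊.+-cong (𝕊.+-cong (𝕊.+-cong (≋-trans (*ₛ-cong (≋-refl {X}) (X*ₛ (D (D Φ)))) (X*ₛ (shift (D (D Φ)))))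
                                       (const-*ₛ (ι q4) (D (D Φ))))
                            (X*ₛ (D Φ)))
                 (𝕊.-‿cong (const-*ₛ (t * t) Φ)) ⟩
    (λ n → shift (shift (D (D Φ))) n + ι q4 * D (D Φ) n + shift (D Φ) n + - (t * t * Φ n)) ∎ₛ

  fallingProd-suc : ∀ {a b} k → b ≈ a + 1# → fallingProd b (suc k) ≈ b * fallingProd a k
  fallingProd-suc {a} {b} zero    b≈a+1 = trans (*-identityˡ _) (trans (+-congˡ (trans (-‿cong nat-0) -0#≈0#))
                                             (trans (+-identityʳ b) (sym (*-identityʳ b))))
  fallingProd-suc {a} {b} (suc k) b≈a+1 = begin
    fallingProd b (suc k) * (b - nat (suc k))           ≈⟨ *-cong (fallingProd-suc k b≈a+1) (+-cong b≈a+1 (-‿cong (nat-suc k))) ⟩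
    b * fallingProd a k * (a + 1# - (nat k + 1#))       ≈⟨ solve 5 (λ x y z w n → x :* y :* (z :+ w :- (n :+ w)) := x :* (y :* (z :- n))) refl
                                                             b (fallingProd a k) a 1# (nat k) ⟩
    b * (fallingProd a k * (a - nat k))                 ∎

  module _ (t : Carrier) where

    private
      Λ : Series
      Λ = Λ₀ t

      Λ-even : ∀ m → Λ (double m) ≈ Λcoef t m
      Λ-even m = reflexive (evenSeries-even (Λcoef t) m)

      Λ-odd : ∀ m → Λ (suc (double m)) ≈ 0#
      Λ-odd m = reflexive (evenSeries-odd (Λcoef t) m)

      𝓛Λ : ℕ → Carrier
      𝓛Λ n = shift (shift (D (D Λ))) n + ι q4 * D (D Λ) n + shift (D Λ) n + - (t * t * Λ n)

      𝓛Λ-odd : ∀ m → 𝓛Λ (suc (double m)) ≈ 0#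
      𝓛Λ-odd m = trans (+-cong (+-cong (+-cong (x²D²Λ-odd m) (trans (*-congˡ (D²Λ-even m)) (zeroʳ _)))
                                      (trans (*-congˡ (Λ-odd m)) (zeroʳ _)))
                              (trans (-‿cong (trans (*-congˡ (Λ-odd m)) (zeroʳ _))) -0#≈0#))
                       (trans (+-identityʳ _) (trans (+-identityʳ _) (+-identityʳ _)))
        where
        D²Λ-even : ∀ m → D (D Λ) (suc (double m)) ≈ 0#
        D²Λ-even m = trans (*-congˡ (trans (*-congˡ (Λ-odd (suc m))) (zeroʳ _))) (zeroʳ _)
        x²D²Λ-odd : ∀ m → shift (shift (D (D Λ))) (suc (double m)) ≈ 0#
        x²D²Λ-odd zero    = refl
        x²D²Λ-odd (suc m) = D²Λ-even m

      𝓛Λ-0 : 𝓛Λ 0 ≈ 0#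
      𝓛Λ-0 = begin
        0# + ι q4 * (nat 1 * (nat 2 * Λcoef t 1)) + 0# + - (t * t * two)
          ≈⟨ +-cong (trans (+-identityʳ _) (+-identityˡ _)) (-‿cong (*-congˡ two≈ι2)) ⟩
        ι q4 * (nat 1 * (nat 2 * Λcoef t 1)) + - (t * t * ι q2)
          ≈⟨ +-congʳ (*-congˡ (*-congˡ (*-congˡ (*-congˡ (*-congʳ (*-congʳ 1≈ι1)))))) ⟩
        ι q4 * (nat 1 * (nat 2 * (t * ι q½ * (ι ℚ.1ℚ * (t * half + nat 0 - nat 0) * ι (invFact 1))))) + - (t * t * ι q2)
          ≈⟨ solve 1 (λ x → con q4 :* (con (+ 1 ℚ./ 1) :* (con q2 :* (x :* con q½ :* (con ℚ.1ℚ :* (x :* con q½ :+ con (+ 0 ℚ./ 1) :- con (+ 0 ℚ./ 1)) :* con (invFact 1)))))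
                              :+ :- (x :* x :* con q2) := con ℚ.0ℚ) refl t ⟩
        ι ℚ.0ℚ
          ≈⟨ 0#-homo ⟩
        0# ∎

      -- The coefficient of x^(2j+2) in 𝓛 t Λ₀ vanishes because
      -- 4 (2j+3) (2j+4) λ_(j+2) = (t² − (2j+2)²) λ_(j+1).
      𝓛Λ-even : ∀ j → 𝓛Λ (double (suc j)) ≈ 0#
      𝓛Λ-even j = begin
        nat (suc d) * (nat (suc (suc d)) * Λ (suc (suc d)))
          + ι q4 * (nat (suc (suc (suc d))) * (nat (suc (suc (suc (suc d)))) * Λ (suc (suc (suc (suc d))))))
          + nat (suc (suc d)) * Λ (suc (suc d)) + - (t * t * Λ (suc (suc d)))
          ≈⟨ +-cong (+-cong (+-cong (*-cong n₁ (*-cong n₂ λ₁)) (*-congˡ (*-cong n₃ (*-cong n₄ λ₂)))) (*-cong n₂ λ₁)) (-‿cong (*-congˡ λ₁)) ⟩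
        v₁ * (v₂ * L₁) + ι q4 * (v₃ * (v₄ * L₂)) + v₂ * L₁ + - (t * t * L₁)
          ≈⟨ solve 7 (λ T N F I r₁ r₂ r₃ →
               let v₁ = con q2 :* N :+ con ℚ.1ℚ ; v₂ = v₁ :+ con ℚ.1ℚ ; v₃ = v₂ :+ con ℚ.1ℚ ; v₄ = v₃ :+ con ℚ.1ℚ
                   L₁ = T :* r₁ :* (F :* I)
                   L₂ = T :* r₃ :* ((T :* con q½ :+ N :+ con ℚ.1ℚ) :* (F :* (T :* con q½ :+ N :- v₁)) :* (I :* r₁ :* r₂))
               in v₁ :* (v₂ :* L₁) :+ con q4 :* (v₃ :* (v₄ :* L₂)) :+ v₂ :* L₁ :+ :- (T :* T :* L₁)
                  := T :* (T :* T :- v₂ :* v₂) :* r₁ :* F :* I :* (v₃ :* r₂ :* (v₄ :* r₃) :- con ℚ.1ℚ))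
               refl t N F I ρ₁ ρ₂ ρ₃ ⟩
        Y * (v₃ * ρ₂ * (v₄ * ρ₃) - o)
          ≈⟨ *-congˡ (+-congʳ (*-cong (trans (*-congʳ (sym n₃)) (trans (nat-suc*inv1+ (suc (suc d))) 1≈ι1))
                                       (trans (*-congʳ (sym n₄)) (trans (nat-suc*inv1+ (suc (suc (suc d)))) 1≈ι1)))) ⟩
        Y * (o * o - o)
          ≈⟨ solve 1 (λ y → y :* (con ℚ.1ℚ :* con ℚ.1ℚ :- con ℚ.1ℚ) := con ℚ.0ℚ) refl Y ⟩
        ι ℚ.0ℚ
          ≈⟨ 0#-homo ⟩
        0# ∎
        where
        d : ℕ
        d = double j
        N o a a′ ρ₁ ρ₂ ρ₃ F I : Carrier
        N  = nat j
        o  = ι ℚ.1ℚ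
        a  = t * half + nat j
        a′ = t * half + nat (suc j)
        ρ₁ = ι (inv1+ (suc d))
        ρ₂ = ι (inv1+ (suc (suc d)))
        ρ₃ = ι (inv1+ (suc (suc (suc d))))
        F  = fallingProd a (suc d)
        I  = ι (invFact (suc d))
        v₁ v₂ v₃ v₄ L₁ L₂ Y : Carrier
        v₁ = ι q2 * N + o
        v₂ = v₁ + o
        v₃ = v₂ + o
        v₄ = v₃ + o
        L₁ = t * ρ₁ * (F * I)
        L₂ = t * ρ₃ * ((t * half + N + o) * (F * (t * half + N - v₁)) * (I * ρ₁ * ρ₂))
        Y  = t * (t * t - v₂ * v₂) * ρ₁ * F * I
        nat-suc′ : ∀ m {v} → nat m ≈ v → nat (suc m) ≈ v + o
        nat-suc′ m nm≈v = trans (nat-suc m) (+-cong nm≈v 1≈ι1)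
        n₁ : nat (suc d) ≈ v₁
        n₁ = nat-suc′ d (nat-double j)
        n₂ : nat (suc (suc d)) ≈ v₂
        n₂ = nat-suc′ (suc d) n₁
        n₃ : nat (suc (suc (suc d))) ≈ v₃
        n₃ = nat-suc′ (suc (suc d)) n₂
        n₄ : nat (suc (suc (suc (suc d)))) ≈ v₄
        n₄ = nat-suc′ (suc (suc (suc d))) n₃
        λ₁ : Λ (suc (suc d)) ≈ L₁
        λ₁ = trans (Λ-even (suc j)) (reflexive (P.cong (λ k → t * ι (inv1+ (suc k)) * binom a (suc k)) (P.sym (double≡2* j))))
        a′≈a+1 : a′ ≈ a + 1#
        a′≈a+1 = trans (+-congˡ (nat-suc j)) (sym (+-assoc _ _ _))
        λ₂ : Λ (suc (suc (suc (suc d)))) ≈ L₂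
        λ₂ = begin
          Λ (double (suc (suc j)))
            ≈⟨ Λ-even (suc (suc j)) ⟩
          Λcoef t (suc (suc j))
            ≈⟨ reflexive (P.cong (λ k → t * ι (inv1+ (suc k)) * binom a′ (suc k)) (P.sym (double≡2* (suc j)))) ⟩
          t * ρ₃ * (fallingProd a′ (suc (suc (suc d))) * ι (invFact (suc d) ℚ.* inv1+ (suc d) ℚ.* inv1+ (suc (suc d))))
            ≈⟨ *-congˡ (*-cong (fallingProd-suc (suc (suc d)) a′≈a+1) (trans (*-homo _ _) (*-congʳ (*-homo _ _)))) ⟩
          t * ρ₃ * (a′ * (F * (a - nat (suc d))) * (I * ρ₁ * ρ₂))
            ≈⟨ *-congˡ (*-congʳ (*-cong (trans a′≈a+1 (+-congˡ 1≈ι1)) (*-congˡ (+-congˡ (-‿cong n₁))))) ⟩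
          L₂ ∎

    𝓛-Λ₀ : 𝓛 t (Λ₀ t) ≋ 0ₛ
    𝓛-Λ₀ = ≋-trans (𝓛-coeff t Λ) (≋0ₛ 𝓛Λ≈0)
      where
      𝓛Λ≈0 : ∀ n → 𝓛Λ n ≈ 0#
      𝓛Λ≈0 n with evenOdd n
      ... | even zero    = 𝓛Λ-0
      ... | even (suc j) = 𝓛Λ-even j
      ... | odd m        = 𝓛Λ-odd m

  -- cosh (t asinh (x/2))

  cosh-even : ∀ m → coshSeries (double m) ≈ ι (invFact (double m))
  cosh-even m = trans (reflexive (evenSeries-even _ m)) (reflexive (P.cong (λ k → ι (invFact k)) (P.sym (double≡2* m))))

  cosh-odd : ∀ m → coshSeries (suc (double m)) ≈ 0#
  cosh-odd m = reflexive (evenSeries-odd _ m)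

  sinh-odd : ∀ m → sinhSeries (suc (double m)) ≈ ι (invFact (suc (double m)))
  sinh-odd m = trans (reflexive (oddSeries-odd _ m)) (reflexive (P.cong (λ k → ι (invFact (suc k))) (P.sym (double≡2* m))))

  sinh-even : ∀ m → sinhSeries (double m) ≈ 0#
  sinh-even m = reflexive (oddSeries-even _ m)

  D-cosh : D coshSeries ≋ sinhSeries
  D-cosh n with evenOdd n
  ... | even m = trans (*-congˡ (cosh-odd m)) (trans (zeroʳ _) (sym (sinh-even m)))
  ... | odd  m = trans (*-congˡ (cosh-even (suc m))) (trans (D-exp (suc (double m))) (sym (sinh-odd m)))

  D-sinh : D sinhSeries ≋ coshSeries
  D-sinh n with evenOdd n
  ... | even m = trans (*-congˡ (sinh-odd m)) (trans (D-exp (double m)) (sym (cosh-even m)))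
  ... | odd  m = trans (*-congˡ (sinh-even (suc m))) (trans (zeroʳ _) (sym (cosh-odd m)))

  -- dilate a f is the series f (a x).
  dilate : Carrier → Series → Series
  dilate a f n = f n * powR a n

  dilate-cong : ∀ a {f g} → f ≋ g → dilate a f ≋ dilate a g
  dilate-cong a f≋g n = *-congʳ (f≋g n)

  dilate-+ₛ : ∀ a f g → dilate a (f +ₛ g) ≋ dilate a f +ₛ dilate a g
  dilate-+ₛ a f g n = distribʳ _ _ _

  dilate-const : ∀ a b → dilate a (const b) ≋ const b
  dilate-const a b zero    = *-identityʳ b
  dilate-const a b (suc n) = zeroˡ _

  powR-+ : ∀ a i k → powR a (i ℕ.+ k) ≈ powR a i * powR a k
  powR-+ a zero    k = sym (*-identityˡ _)
  powR-+ a (suc i) k = trans (*-congˡ (powR-+ a i k)) (sym (*-assoc _ _ _))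

  dilate-*ₛ : ∀ a f g → dilate a (f *ₛ g) ≋ dilate a f *ₛ dilate a g
  dilate-*ₛ a f g n = trans (*-distribʳ-sumTo (suc n) _ _) (sumTo-cong-< (suc n) (λ i i<1+n → begin
    f i * g (n ∸ i) * powR a n
      ≈⟨ *-congˡ (trans (reflexive (P.cong (powR a) (P.sym (ℕₚ.m+[n∸m]≡n (ℕₚ.≤-pred i<1+n))))) (powR-+ a i (n ∸ i))) ⟩
    f i * g (n ∸ i) * (powR a i * powR a (n ∸ i))
      ≈⟨ solve 4 (λ x y p q → x :* y :* (p :* q) := x :* p :* (y :* q)) refl (f i) (g (n ∸ i)) (powR a i) (powR a (n ∸ i)) ⟩
    f i * powR a i * (g (n ∸ i) * powR a (n ∸ i)) ∎))

  dilate-X : ∀ a → dilate a X ≋ a ·ₛ X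
  dilate-X a zero          = trans (zeroˡ _) (sym (zeroʳ _))
  dilate-X a (suc zero)    = trans (*-identityˡ _) (trans (*-identityʳ _) (sym (*-identityʳ _)))
  dilate-X a (suc (suc n)) = trans (zeroˡ _) (sym (zeroʳ _))

  kronecker : ℕ → ℕ → Carrier
  kronecker zero    zero    = 1#
  kronecker zero    (suc n) = 0#
  kronecker (suc j) zero    = 0#
  kronecker (suc j) (suc n) = kronecker j n

  kronecker-≢ : ∀ j n → j P.≢ n → kronecker j n ≈ 0#
  kronecker-≢ zero    zero    j≢n = ⊥-elim (j≢n P.refl)
  kronecker-≢ zero    (suc n) j≢n = refl
  kronecker-≢ (suc j) zero    j≢n = refl
  kronecker-≢ (suc j) (suc n) j≢n = kronecker-≢ j n (λ j≡n → j≢n (P.cong suc j≡n))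

  kronecker-≡ : ∀ n → kronecker n n ≈ 1#
  kronecker-≡ zero    = refl
  kronecker-≡ (suc n) = kronecker-≡ n

  powS-X : ∀ j n → powS X j n ≈ kronecker j n
  powS-X zero    zero    = refl
  powS-X zero    (suc n) = refl
  powS-X (suc j) zero    = X*ₛ (powS X j) 0
  powS-X (suc j) (suc n) = trans (X*ₛ (powS X j) (suc n)) (powS-X j n)

  powS-cong : ∀ j {f g} → f ≋ g → powS f j ≋ powS g j
  powS-cong zero    f≋g = ≋-refl
  powS-cong (suc j) f≋g = *ₛ-cong f≋g (powS-cong j f≋g)

  powS-dilate : ∀ a f j → powS (dilate a f) j ≋ dilate a (powS f j)
  powS-dilate a f zero    = ≋-sym (dilate-const a 1#)
  powS-dilate a f (suc j) = ≋-trans (*ₛ-cong (≋-refl {dilate a f}) (powS-dilate a f j)) (≋-sym (dilate-*ₛ a f (powS f j)))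

  ∘ₛ-scaledX : ∀ a f → f ∘ₛ (a ·ₛ X) ≋ dilate a f
  ∘ₛ-scaledX a f n = begin
    sumTo (suc n) (λ j → f j * powS (a ·ₛ X) j n)
      ≈⟨ sumTo-cong (suc n) (λ j → *-congˡ (trans (powS-aX j n) (*-congʳ (powS-X j n)))) ⟩
    sumTo (suc n) (λ j → f j * (kronecker j n * powR a n))
      ≈⟨ sumTo-single (suc n) n _ (ℕₚ.n<1+n n) (λ j _ j≢n → trans (*-congˡ (trans (*-congʳ (kronecker-≢ j n j≢n)) (zeroˡ _))) (zeroʳ _)) ⟩
    f n * (kronecker n n * powR a n)
      ≈⟨ *-congˡ (trans (*-congʳ (kronecker-≡ n)) (*-identityˡ _)) ⟩
    dilate a f n ∎
    where
    powS-aX : ∀ j → powS (a ·ₛ X) j ≋ dilate a (powS X j)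
    powS-aX j = ≋-trans (powS-cong j (≋-sym (dilate-X a))) (powS-dilate a X j)

  module _ (asinh : Series) (asinh-head : asinh 0 ≈ 0#) (sinh∘asinh : sinhSeries ∘ₛ asinh ≋ X) where

    private
      cosh∘asinh : Series
      cosh∘asinh = coshSeries ∘ₛ asinh

      cosh∘asinh*D-asinh : cosh∘asinh *ₛ D asinh ≋ 1ₛ
      cosh∘asinh*D-asinh = ≋-trans (≋-sym (≋-trans (D-∘ₛ sinhSeries asinh asinh-head) (*ₛ-cong (∘ₛ-congˡ asinh D-sinh) (≋-refl {D asinh}))))
                                  (≋-trans (D-cong sinh∘asinh) D-X)

      D-cosh∘asinh : D cosh∘asinh ≋ X *ₛ D asinh
      D-cosh∘asinh = ≋-trans (D-∘ₛ coshSeries asinh asinh-head) (*ₛ-cong (≋-trans (∘ₛ-congˡ asinh D-cosh) sinh∘asinh) (≋-refl {D asinh}))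

      cosh∘asinh-head : cosh∘asinh 0 ≈ 1#
      cosh∘asinh-head = trans (∘ₛ-head coshSeries asinh) 1#-homo

      -- cosh² = 1 + sinh², composed with asinh.
      cosh∘asinh² : cosh∘asinh *ₛ cosh∘asinh ≋ κ ℚ.1ℚ +ₛ (X *ₛ X)
      cosh∘asinh² = ≋-from-difference (ch *ₛ ch) (κ ℚ.1ℚ +ₛ (X *ₛ X))
        (linearODE₁-zero w 1ₛ 0ₛ 1# (*-identityˡ 1#) w₀≈0
          (≋-trans (*ₛ-cong D-w≋0 (≋-refl {1ₛ})) (≋-trans (𝕊.zeroˡ 1ₛ) (≋-sym (𝕊.zeroʳ w)))))
        where
        ch w : Series
        ch = cosh∘asinh
        w = (ch *ₛ ch) -ₛ (κ ℚ.1ℚ +ₛ (X *ₛ X))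
        D-w≋0 : D w ≋ 0ₛ
        D-w≋0 = beginₛ
          D w
            ≋⟨ ≋-trans (D-+ₛ (ch *ₛ ch) (-ₛ (κ ℚ.1ℚ +ₛ (X *ₛ X)))) (𝕊.+-cong (D-*ₛ ch ch)
                 (≋-trans (D-negₛ (κ ℚ.1ℚ +ₛ (X *ₛ X))) (𝕊.-‿cong (≋-trans (D-+ₛ (κ ℚ.1ℚ) (X *ₛ X)) (𝕊.+-cong (D-const (ι ℚ.1ℚ)) (D-*ₛ X X)))))) ⟩
          ((D ch *ₛ ch) +ₛ (ch *ₛ D ch)) -ₛ (0ₛ +ₛ ((D X *ₛ X) +ₛ (X *ₛ D X)))
            ≋⟨ 𝕊.+-cong (𝕊.+-cong (*ₛ-cong D-cosh∘asinh (≋-refl {ch})) (*ₛ-cong (≋-refl {ch}) D-cosh∘asinh))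
                        (𝕊.-‿cong (𝕊.+-cong 0ₛ≋κ0 (𝕊.+-cong (*ₛ-cong D-X≋κ1 (≋-refl {X})) (*ₛ-cong (≋-refl {X}) D-X≋κ1)))) ⟩
          (((X *ₛ D asinh) *ₛ ch) +ₛ (ch *ₛ (X *ₛ D asinh))) -ₛ (κ ℚ.0ℚ +ₛ ((κ ℚ.1ℚ *ₛ X) +ₛ (X *ₛ κ ℚ.1ℚ)))
            ≋⟨ solveₛ 3 (λ x d y → x ⊗ d ⊗ y ⊕ y ⊗ (x ⊗ d) ⊖ (κ̂ ℚ.0ℚ ⊕ (κ̂ ℚ.1ℚ ⊗ x ⊕ x ⊗ κ̂ ℚ.1ℚ)) ⊜ (x ⊕ x) ⊗ (y ⊗ d) ⊖ (x ⊕ x))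
                 𝕊.refl X (D asinh) ch ⟩
          ((X +ₛ X) *ₛ (ch *ₛ D asinh)) -ₛ (X +ₛ X)
            ≋⟨ 𝕊.+-congʳ (*ₛ-cong (≋-refl {X +ₛ X}) cosh∘asinh*D-asinh) ⟩
          ((X +ₛ X) *ₛ 1ₛ) -ₛ (X +ₛ X)
            ≋⟨ 𝕊.+-congʳ (𝕊.*-identityʳ (X +ₛ X)) ⟩
          (X +ₛ X) -ₛ (X +ₛ X)
            ≋⟨ 𝕊.-‿inverseʳ (X +ₛ X) ⟩
          0ₛ ∎ₛ
          where D-X≋κ1 = ≋-trans D-X 1ₛ≋κ1
        w₀≈0 : w 0 ≈ 0#
        w₀≈0 = begin
          0# + ch 0 * ch 0 - (ι ℚ.1ℚ + (0# + X 0 * X 0))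
            ≈⟨ +-cong (trans (+-identityˡ _) (*-cong cosh∘asinh-head cosh∘asinh-head)) (-‿cong (+-congˡ (trans (+-identityˡ _) (zeroˡ _)))) ⟩
          1# * 1# - (ι ℚ.1ℚ + 0#)
            ≈⟨ +-cong (trans (*-identityˡ _) 1≈ι1) (-‿cong (+-identityʳ _)) ⟩
          ι ℚ.1ℚ - ι ℚ.1ℚ
            ≈⟨ -‿inverseʳ _ ⟩
          0# ∎

      -- Both sides square to x² + 4, and their sum has invertible constant term.
      √≋2cosh∘asinh[x/2] : √ ≋ κ q2 *ₛ dilate half cosh∘asinh
      √≋2cosh∘asinh[x/2] = ≋-from-difference √ (κ q2 *ₛ K) (*ₛ-unit-cancelʳ w (√ +ₛ (κ q2 *ₛ K)) (ι q¼) head-invertible (beginₛ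
        w *ₛ (√ +ₛ (κ q2 *ₛ K))
          ≋⟨ solveₛ 2 (λ s k → (s ⊖ κ̂ q2 ⊗ k) ⊗ (s ⊕ κ̂ q2 ⊗ k) ⊜ s ⊗ s ⊖ κ̂ q4 ⊗ (k ⊗ k)) 𝕊.refl √ K ⟩
        (√ *ₛ √) -ₛ (κ q4 *ₛ (K *ₛ K))
          ≋⟨ 𝕊.+-cong √*√ (𝕊.-‿cong (*ₛ-cong (≋-refl {κ q4}) K*K)) ⟩
        x²+4 -ₛ (κ q4 *ₛ (κ ℚ.1ℚ +ₛ ((κ q½ *ₛ X) *ₛ (κ q½ *ₛ X))))
          ≋⟨ solveₛ 1 (λ x → x ⊗ x ⊕ κ̂ q4 ⊖ κ̂ q4 ⊗ (κ̂ ℚ.1ℚ ⊕ κ̂ q½ ⊗ x ⊗ (κ̂ q½ ⊗ x)) ⊜ κ̂ ℚ.0ℚ) 𝕊.refl X ⟩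
        κ ℚ.0ℚ
          ≋⟨ ≋-sym 0ₛ≋κ0 ⟩
        0ₛ ∎ₛ))
        where
        K w : Series
        K = dilate half cosh∘asinh
        w = √ -ₛ (κ q2 *ₛ K)
        K*K : K *ₛ K ≋ κ ℚ.1ℚ +ₛ ((κ q½ *ₛ X) *ₛ (κ q½ *ₛ X))
        K*K = beginₛ
          K *ₛ K                                             ≋⟨ ≋-sym (dilate-*ₛ half cosh∘asinh cosh∘asinh) ⟩
          dilate half (cosh∘asinh *ₛ cosh∘asinh)             ≋⟨ dilate-cong half cosh∘asinh² ⟩
          dilate half (κ ℚ.1ℚ +ₛ (X *ₛ X))                   ≋⟨ dilate-+ₛ half (κ ℚ.1ℚ) (X *ₛ X) ⟩
          dilate half (κ ℚ.1ℚ) +ₛ dilate half (X *ₛ X)       ≋⟨ 𝕊.+-cong (dilate-const half (ι ℚ.1ℚ)) (dilate-*ₛ half X X) ⟩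
          κ ℚ.1ℚ +ₛ (dilate half X *ₛ dilate half X)         ≋⟨ 𝕊.+-congˡ (*ₛ-cong halfX≋ halfX≋) ⟩
          κ ℚ.1ℚ +ₛ ((κ q½ *ₛ X) *ₛ (κ q½ *ₛ X))             ∎ₛ
          where
          halfX≋ : dilate half X ≋ κ q½ *ₛ X
          halfX≋ = ≋-trans (dilate-X half) (≋-sym (const-*ₛ half X))
        head-invertible : (√ +ₛ (κ q2 *ₛ K)) 0 * ι q¼ ≈ 1#
        head-invertible = begin
          (√ 0 + (0# + ι q2 * K 0)) * ι q¼
            ≈⟨ *-congʳ (+-cong √-head (trans (+-identityˡ _) (*-congˡ (trans (*-identityʳ _) (trans cosh∘asinh-head 1≈ι1))))) ⟩
          (ι q2 + ι q2 * ι ℚ.1ℚ) * ι q¼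
            ≈⟨ solve 0 ((con q2 :+ con q2 :* con ℚ.1ℚ) :* con q¼ := con ℚ.1ℚ) refl ⟩
          ι ℚ.1ℚ
            ≈⟨ 1#-homo ⟩
          1# ∎

      asinh[x/2] : Series
      asinh[x/2] = asinh ∘ₛ halfX

      asinh[x/2]-head : asinh[x/2] 0 ≈ 0#
      asinh[x/2]-head = trans (∘ₛ-head asinh halfX) asinh-head

      D-asinh[x/2]*√ : D asinh[x/2] *ₛ √ ≋ 1ₛ
      D-asinh[x/2]*√ = beginₛ
        D asinh[x/2] *ₛ √
          ≋⟨ *ₛ-cong D-asinh[x/2] √≋2cosh∘asinh[x/2] ⟩
        (dilate half (D asinh) *ₛ κ q½) *ₛ (κ q2 *ₛ dilate half cosh∘asinh)
          ≋⟨ solveₛ 2 (λ d k → d ⊗ κ̂ q½ ⊗ (κ̂ q2 ⊗ k) ⊜ κ̂ ℚ.1ℚ ⊗ (k ⊗ d)) 𝕊.refl (dilate half (D asinh)) (dilate half cosh∘asinh) ⟩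
        κ ℚ.1ℚ *ₛ (dilate half cosh∘asinh *ₛ dilate half (D asinh))
          ≋⟨ *ₛ-cong (≋-sym 1ₛ≋κ1) (≋-trans (≋-sym (dilate-*ₛ half cosh∘asinh (D asinh)))
               (≋-trans (dilate-cong half cosh∘asinh*D-asinh) (dilate-const half 1#))) ⟩
        1ₛ *ₛ 1ₛ
          ≋⟨ *ₛ-identityˡ 1ₛ ⟩
        1ₛ ∎ₛ
        where
        D-asinh[x/2] : D asinh[x/2] ≋ dilate half (D asinh) *ₛ κ q½
        D-asinh[x/2] = ≋-trans (D-∘ₛ asinh halfX (zeroʳ half)) (*ₛ-cong (∘ₛ-scaledX half (D asinh)) D-halfX)
          where
          D-halfX : D halfX ≋ κ q½
          D-halfX = ≋-trans (D-·ₛ half X) (≋-trans (λ n → *-congˡ (D-X n)) (≋-trans (≋-sym (const-*ₛ half 1ₛ)) (𝕊.*-identityʳ (κ q½))))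

    α±≋2cosh[t·asinh[x/2]] : ∀ t → α± t ≋ two ·ₛ (coshSeries ∘ₛ (t ·ₛ asinh[x/2]))
    α±≋2cosh[t·asinh[x/2]] t = ≋-trans (𝓛-unique t (α± t) (κ q2 *ₛ C) (𝓛-α± t) 𝓛-2C head coeff₁)
                                          (≋-trans (const-*ₛ (ι q2) C) (λ n → *-congʳ (sym two≈ι2)))
      where
      tB C S : Series
      tB = t ·ₛ asinh[x/2]
      C  = coshSeries ∘ₛ tB
      S  = sinhSeries ∘ₛ tB
      tB-head : tB 0 ≈ 0#
      tB-head = trans (*-congˡ asinh[x/2]-head) (zeroʳ t)
      D-tB : D tB ≋ const t *ₛ D asinh[x/2]
      D-tB = ≋-trans (D-·ₛ t asinh[x/2]) (≋-sym (const-*ₛ t (D asinh[x/2])))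
      D-C : D C ≋ S *ₛ (const t *ₛ D asinh[x/2])
      D-C = ≋-trans (D-∘ₛ coshSeries tB tB-head) (*ₛ-cong (∘ₛ-congˡ tB D-cosh) D-tB)
      D-S : D S ≋ C *ₛ (const t *ₛ D asinh[x/2])
      D-S = ≋-trans (D-∘ₛ sinhSeries tB tB-head) (*ₛ-cong (∘ₛ-congˡ tB D-sinh) D-tB)
      𝓛-2C : 𝓛 t (κ q2 *ₛ C) ≋ 0ₛ
      𝓛-2C = ≋-trans (𝓛-κ*ₛ t q2 C) (≋-trans (*ₛ-cong (≋-refl {κ q2}) (𝓛-hyperbolicPair t C S (D asinh[x/2]) D-asinh[x/2]*√ D-C D-S))
               (𝕊.zeroʳ (κ q2)))
      C-head : C 0 ≈ 1#
      C-head = trans (∘ₛ-head coshSeries tB) 1#-homo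
      head : α± t 0 ≈ (κ q2 *ₛ C) 0
      head = trans (α±-head t) (trans two≈ι2 (sym (trans (+-identityˡ _) (trans (*-congˡ C-head) (*-identityʳ _)))))
      coeff₁ : α± t 1 ≈ (κ q2 *ₛ C) 1
      coeff₁ = trans (α±-coeff-1 t) (sym (begin
        0# + ι q2 * C 1 + 0# * C 0      ≈⟨ trans (+-congˡ (zeroˡ _)) (trans (+-identityʳ _) (+-identityˡ _)) ⟩
        ι q2 * C 1                      ≈⟨ *-congˡ (coeff-1 t C S (D asinh[x/2]) D-C) ⟩
        ι q2 * (S 0 * (t * D asinh[x/2] 0)) ≈⟨ *-congˡ (trans (*-congʳ (∘ₛ-head sinhSeries tB)) (zeroˡ _)) ⟩
        ι q2 * 0#                       ≈⟨ zeroʳ _ ⟩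
        0#                              ∎))

  Λ₀≋α± : ∀ t → Λ₀ t ≋ α± t
  Λ₀≋α± t = 𝓛-unique t (Λ₀ t) (α± t) (𝓛-Λ₀ t) (𝓛-α± t) (sym (α±-head t)) (sym (α±-coeff-1 t))

mainTheorem3 : ∀ {c ℓ} (A : QAlgebra c ℓ) → let open QAlgebra A in let open PowerSeries A in
    ∀ (t : Carrier) →
      (Λ₀ t ≋ αpow t +ₛ αpow (- t))
      × (∀ (asinh : Series) → IsSinhInverse asinh →
           αpow t +ₛ αpow (- t) ≋ two ·ₛ (coshSeries ∘ₛ (t ·ₛ (asinh ∘ₛ halfX))))
mainTheorem3 A t = Λ₀≋α± t , λ asinh (asinh-head , sinh∘asinh , _) → α±≋2cosh[t·asinh[x/2]] asinh asinh-head sinh∘asinh t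
  where open PowerSeriesCalculus A
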